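{- For any $r$-hourglass plabic graphs $G$ and $G'$ related by a square move, $\mathrm{trip}_i(G)=\mathrm{trip}_i(G')$ for all $1\le i\le r-1$.
   Context: $r$-hourglass plabic graph: bipartite planar graph in a disk with fixed black–white coloring and positive integer edge multiplicities (an $m$-hourglass drawn as $m$ strands twisted so the clockwise order of strands agrees at both ends), internal vertices of degree $r$ counted with multiplicity, boundary vertices of simple degree one labeled $b_1,\dots,b_n$ clockwise. $\mathrm{trip}_i(G)(j)=k$ if the walk from $b_j$ along strands taking the $i$-th leftmost turn at each white vertex and $i$-th rightmost turn at each black vertex ends at $b_k$. Square move: for a face bounded by a 4-cycle $v_1v_2v_3v_4$ (clockwise) whose edges $e_i=v_iv_{i+1}$ (indices mod 4) have multiplicities $m_i$ with $m_1+m_2+m_3+m_4=r$, delete the $e_i$, add new vertices $w_1,\dots,w_4$ inside the face with $w_i$ of color opposite to $v_i$, join $v_i$ to $w_i$ by an edge of multiplicity $m_{i-1}+m_i$, and $w_i$ to $w_{i+1}$ by an edge of multiplicity $m_{i+2}$; all other edges and multiplicities unchanged. Its inverse is also a square move (and a square move may be followed by contraction moves: deleting an internal vertex of simple degree 2 joined by an $a$- and an $(r-a)$-hourglass to internal vertices $u,u'$ and identifying $u$ with $u'$). -}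

module Defs where

open import Data.Nat using (ℕ; zero; suc; _+_; _*_; _∸_; _≤_; _<_; _≤ᵇ_; s≤s; z≤n)
open import Data.Nat.Properties using (n<1+n; ≤-trans; n≤1+n; _<?_)
open import Data.Bool using (Bool; true; false; if_then_else_; _∧_; _∨_)
open import Data.Fin using (Fin; zero; suc; toℕ; fromℕ; inject₁; _≟_)
open import Data.Sum using (_⊎_; inj₁; inj₂; map₁)
open import Data.Sum.Properties using (≡-dec)
open import Data.Product using (Σ; Σ-syntax; ∃; ∃-syntax; _×_; _,_; proj₁)
open import Relation.Nullary using (¬_; yes; no)
open import Relation.Nullary.Decidable using (⌊_⌋)
open import Relation.Binary.PropositionalEquality using (_≡_; _≢_; subst; sym)
open import Relation.Binary.Construct.Closure.ReflexiveTransitive using (Star)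
open import Function using (_∘_)

iter : ∀ {A : Set} → (A → A) → ℕ → A → A
iter f zero a = a
iter f (suc k) a = f (iter f k a)

sumFin : ∀ {N} → (Fin N → ℕ) → ℕ
sumFin {zero} f = 0
sumFin {suc N} f = f zero + sumFin (f ∘ suc)

countFin : ∀ {N} → (Fin N → Bool) → ℕ
countFin f = sumFin (λ x → if f x then 1 else 0)

allFinB : ∀ {N} → (Fin N → Bool) → Bool
allFinB {zero} f = true
allFinB {suc N} f = f zero ∧ allFinB (f ∘ suc)

anyFinB : ∀ {N} → (Fin N → Bool) → Bool
anyFinB {zero} f = false
anyFinB {suc N} f = f zero ∨ anyFinB (f ∘ suc)

allBelow : ℕ → (ℕ → Bool) → Bool
allBelow zero p = true
allBelow (suc k) p = p k ∧ allBelow k p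

-- number of orbits of a permutation f of Fin N
-- (= number of x which are the minimum of their orbit)
numOrbits : ∀ {N} → (Fin N → Fin N) → ℕ
numOrbits {N} f = countFin (λ x → allBelow N (λ k → toℕ x ≤ᵇ toℕ (iter f k x)))

reachB : ∀ {N} → (Fin N → Fin N) → (Fin N → Fin N) → ℕ → Fin N → Fin N → Bool
reachB f g zero x y = ⌊ x ≟ y ⌋
reachB f g (suc k) x y =
  reachB f g k x y ∨ anyFinB (λ z → reachB f g k x z ∧ (⌊ f z ≟ y ⌋ ∨ ⌊ g z ≟ y ⌋))

numComponents : ∀ {N} → (Fin N → Fin N) → (Fin N → Fin N) → ℕ
numComponents {N} f g =
  countFin (λ x → allFinB (λ y → if reachB f g N x y then toℕ x ≤ᵇ toℕ y else true))

cycPred : ∀ {n} → Fin n → Fin n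
cycPred {suc m} zero = fromℕ m
cycPred {suc m} (suc j) = inject₁ j

data Color : Set where
  black white : Color

flipColor : Color → Color
flipColor black = white
flipColor white = black

-- Sphere rotation: the boundary vertices b_1..b_n (each of simple degree
-- one) are merged into one extra vertex ∞ outside the disk, whose
-- clockwise rotation is dart(b_j) ↦ dart(b_{j-1}).

sphRot : ∀ {nD nV n} → (Fin nD → Fin nV ⊎ Fin n) → (Fin nD → Fin nD)
         → (Fin n → Fin nD) → Fin nD → Fin nD
sphRot at rot bd x with at x
... | inj₁ _ = rot x
... | inj₂ j = bd (cycPred j)

-- Euler condition: V - E + F = 2·(#components) on the sphere, i.e. every
-- connected component is embedded with genus 0 (planarity in the disk).
Planar : ∀ {nD nV n} → (Fin nD → Fin nV ⊎ Fin n) → (Fin nD → Fin nD)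
         → (Fin nD → Fin nD) → (Fin n → Fin nD) → Set
Planar {nD} at opp rot bd =
  2 * (numOrbits ρ + numOrbits (ρ ∘ opp)) ≡ nD + 4 * numComponents ρ opp
  where ρ = sphRot at rot bd

-- Darts (half-edges) are Fin nD; internal vertices
-- are Fin nV; boundary vertex b_j is inj₂ j.
--   opp x  : the other half of the edge of x
--   rot x  : the next dart clockwise around the vertex of x
--   mult x : multiplicity of the edge of x (an m-hourglass)

record HPG (r n : ℕ) : Set where
  field
    nV nD : ℕ
    color : Fin nV → Color
    at : Fin nD → Fin nV ⊎ Fin n
    opp rot rot⁻¹ : Fin nD → Fin nD
    mult : Fin nD → ℕ
    bd : Fin n → Fin nD
    opp-invol : ∀ x → opp (opp x) ≡ x
    opp-no-fix : ∀ x → opp x ≢ x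
    mult-pos : ∀ x → 0 < mult x
    mult-opp : ∀ x → mult (opp x) ≡ mult x
    rot-inv-l : ∀ x → rot⁻¹ (rot x) ≡ x
    rot-inv-r : ∀ x → rot (rot⁻¹ x) ≡ x
    rot-at : ∀ x → at (rot x) ≡ at x
    rot-cycle : ∀ x y → at x ≡ at y → ∃[ k ] iter rot k x ≡ y
    bd-at : ∀ j → at (bd j) ≡ inj₂ j
    bd-unique : ∀ x j → at x ≡ inj₂ j → x ≡ bd j
    bd-simple : ∀ j → mult (bd j) ≡ 1
    degree : ∀ v →
      sumFin (λ x → if ⌊ ≡-dec _≟_ _≟_ (at x) (inj₁ v) ⌋ then mult x else 0) ≡ r
    bipartite : ∀ x u w → at x ≡ inj₁ u → at (opp x) ≡ inj₁ w → color u ≢ color w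
    planar : Planar at opp rot bd

open HPG public

-- strand-end: strand number p (0-based, in clockwise order) of the
-- hourglass of dart x, seen at the vertex of x
StrandEnd : ∀ {r n} → HPG r n → Set
StrandEnd G = Σ[ x ∈ Fin (nD G) ] Σ[ p ∈ ℕ ] p < mult G x

private
  lastLt : ∀ {m} → 0 < m → m ∸ 1 < m
  lastLt {suc m} _ = n<1+n m

cw : ∀ {r n} (G : HPG r n) → StrandEnd G → StrandEnd G
cw G (x , p , lt) with suc p <? mult G x
... | yes q = x , suc p , q
... | no _ = rot G x , 0 , mult-pos G (rot G x)

ccw : ∀ {r n} (G : HPG r n) → StrandEnd G → StrandEnd G
ccw G (x , zero , lt) =
  rot⁻¹ G x , mult G (rot⁻¹ G x) ∸ 1 , lastLt (mult-pos G (rot⁻¹ G x))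
ccw G (x , suc p , lt) = x , p , ≤-trans (n≤1+n (suc p)) lt

-- traverse the hourglass: the hourglass is twisted so that the p-th strand
-- clockwise at one end is the p-th strand clockwise at the other end
cross : ∀ {r n} (G : HPG r n) → StrandEnd G → StrandEnd G
cross G (x , p , lt) = opp G x , p , subst (p <_) (sym (mult-opp G x)) lt

-- i-th leftmost turn (white) / i-th rightmost turn (black)
turn : ∀ {r n} (G : HPG r n) → Color → ℕ → StrandEnd G → StrandEnd G
turn G white i = iter (cw G) i
turn G black i = iter (ccw G) i

-- Reaches G i s k : the walk having just arrived along strand-end s ends at b_k
data Reaches {r n} (G : HPG r n) (i : ℕ) : StrandEnd G → Fin n → Set where
  done : ∀ {s k} → at G (proj₁ s) ≡ inj₂ k → Reaches G i s k
  step : ∀ {s k v} → at G (proj₁ s) ≡ inj₁ v →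
         Reaches G i (cross G (turn G (color G v) i s)) k → Reaches G i s k

Trip : ∀ {r n} → HPG r n → ℕ → Fin n → Fin n → Set
Trip G i j k = Reaches G i (cross G (bd G j , 0 , mult-pos G (bd G j))) k

nx pv : Fin 4 → Fin 4
nx zero = suc zero
nx (suc zero) = suc (suc zero)
nx (suc (suc zero)) = suc (suc (suc zero))
nx (suc (suc (suc zero))) = zero
pv zero = suc (suc (suc zero))
pv (suc zero) = zero
pv (suc (suc zero)) = suc zero
pv (suc (suc (suc zero))) = suc (suc zero)

-- new darts created by the square move
--   vw i  : at v_i towards w_i        wv i  : at w_i towards v_i
--   ww i  : at w_i towards w_{i+1}     ww' i : at w_{i+1} towards w_i
data NewDart : Set where
  vw wv ww ww' : Fin 4 → NewDart

oppNew : NewDart → NewDart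
oppNew (vw i) = wv i
oppNew (wv i) = vw i
oppNew (ww i) = ww' i
oppNew (ww' i) = ww i

FaceDart : ∀ {r n} (G : HPG r n) → (Fin 4 → Fin (nD G)) → Fin (nD G) → Set
FaceDart G x y = ∃[ i ] (y ≡ x i ⊎ y ≡ opp G (x i))

-- G' is (isomorphic to) the result of a square move on G at the face
-- v_1 v_2 v_3 v_4 (clockwise); x i is the dart of e_i = v_i v_{i+1} at v_i.
record SquareMove {r n} (G G' : HPG r n) : Set where
  field
    x : Fin 4 → Fin (nD G)
    v : Fin 4 → Fin (nV G)
    x-at : ∀ i → at G (x i) ≡ inj₁ (v i)
    v-distinct : ∀ i j → v i ≡ v j → i ≡ j
    face : ∀ i → rot G (x (nx i)) ≡ opp G (x i)
    mult-sum : mult G (x zero) + mult G (x (suc zero)) + mult G (x (suc (suc zero)))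
               + mult G (x (suc (suc (suc zero)))) ≡ r
    oldV : Fin (nV G) → Fin (nV G')
    newV : Fin 4 → Fin (nV G')
    oldD : Fin (nD G) → Fin (nD G')
    newD : NewDart → Fin (nD G')
    oldV-inj : ∀ a b → oldV a ≡ oldV b → a ≡ b
    newV-inj : ∀ i j → newV i ≡ newV j → i ≡ j
    oldV≢newV : ∀ a i → oldV a ≢ newV i
    V-surj : ∀ w → (∃[ a ] oldV a ≡ w) ⊎ (∃[ i ] newV i ≡ w)
    oldD-inj : ∀ y z → ¬ FaceDart G x y → ¬ FaceDart G x z → oldD y ≡ oldD z → y ≡ z
    newD-inj : ∀ s t → newD s ≡ newD t → s ≡ t
    oldD≢newD : ∀ y t → ¬ FaceDart G x y → oldD y ≢ newD t
    D-surj : ∀ d → (∃[ y ] (¬ FaceDart G x y × oldD y ≡ d)) ⊎ (∃[ t ] newD t ≡ d)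
    color-old : ∀ a → color G' (oldV a) ≡ color G a
    color-new : ∀ i → color G' (newV i) ≡ flipColor (color G (v i))
    at-old : ∀ y → ¬ FaceDart G x y → at G' (oldD y) ≡ map₁ oldV (at G y)
    at-vw : ∀ i → at G' (newD (vw i)) ≡ inj₁ (oldV (v i))
    at-wv : ∀ i → at G' (newD (wv i)) ≡ inj₁ (newV i)
    at-ww : ∀ i → at G' (newD (ww i)) ≡ inj₁ (newV i)
    at-ww' : ∀ i → at G' (newD (ww' i)) ≡ inj₁ (newV (nx i))
    opp-old : ∀ y → ¬ FaceDart G x y → opp G' (oldD y) ≡ oldD (opp G y)
    opp-new : ∀ t → opp G' (newD t) ≡ newD (oppNew t)
    mult-old : ∀ y → ¬ FaceDart G x y → mult G' (oldD y) ≡ mult G y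
    mult-vw : ∀ i → mult G' (newD (vw i)) ≡ mult G (x (pv i)) + mult G (x i)
    mult-ww : ∀ i → mult G' (newD (ww i)) ≡ mult G (x (nx (nx i)))
    rot-old : ∀ y → ¬ FaceDart G x y → ¬ FaceDart G x (rot G y) →
              rot G' (oldD y) ≡ oldD (rot G y)
    rot-old-vw : ∀ y i → ¬ FaceDart G x y → rot G y ≡ x i →
                 rot G' (oldD y) ≡ newD (vw i)
    rot-vw-old : ∀ i → ¬ FaceDart G x (rot G (opp G (x (pv i)))) →
                 rot G' (newD (vw i)) ≡ oldD (rot G (opp G (x (pv i))))
    rot-vw-vw : ∀ i → rot G (opp G (x (pv i))) ≡ x i →
                rot G' (newD (vw i)) ≡ newD (vw i)
    rot-wv : ∀ i → rot G' (newD (wv i)) ≡ newD (ww i)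
    rot-ww : ∀ i → rot G' (newD (ww i)) ≡ newD (ww' (pv i))
    rot-ww' : ∀ i → rot G' (newD (ww' i)) ≡ newD (wv (nx i))

-- Contraction move: delete internal vertex u of simple degree 2, joined
-- to internal vertices p₁ ≠ p₂ (by an a- and an (r-a)-hourglass), and
-- identify p₁ with p₂.

Removed : ∀ {r n} (G : HPG r n) → Fin (nD G) → Fin (nD G) → Fin (nD G) → Set
Removed G y₁ y₂ z = z ≡ y₁ ⊎ z ≡ y₂ ⊎ z ≡ opp G y₁ ⊎ z ≡ opp G y₂

record Contraction {r n} (G G' : HPG r n) : Set where
  field
    u : Fin (nV G)
    y₁ y₂ : Fin (nD G)
    y₁-at : at G y₁ ≡ inj₁ u
    y₂-at : at G y₂ ≡ inj₁ u
    y₁≢y₂ : y₁ ≢ y₂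
    simple-deg-2 : ∀ z → at G z ≡ inj₁ u → z ≡ y₁ ⊎ z ≡ y₂
    mult-sum : mult G y₁ + mult G y₂ ≡ r
    p₁ p₂ : Fin (nV G)
    p₁-at : at G (opp G y₁) ≡ inj₁ p₁
    p₂-at : at G (opp G y₂) ≡ inj₁ p₂
    p₁≢p₂ : p₁ ≢ p₂
    mV : Fin (nV G) → Fin (nV G')
    mV-merge : mV p₁ ≡ mV p₂
    mV-inj : ∀ a b → a ≢ u → b ≢ u → mV a ≡ mV b →
             a ≡ b ⊎ (a ≡ p₁ × b ≡ p₂) ⊎ (a ≡ p₂ × b ≡ p₁)
    mV-surj : ∀ w → ∃[ a ] (a ≢ u × mV a ≡ w)
    color-m : ∀ a → a ≢ u → color G' (mV a) ≡ color G a
    mD : Fin (nD G) → Fin (nD G')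
    mD-inj : ∀ y z → ¬ Removed G y₁ y₂ y → ¬ Removed G y₁ y₂ z → mD y ≡ mD z → y ≡ z
    mD-surj : ∀ d → ∃[ y ] (¬ Removed G y₁ y₂ y × mD y ≡ d)
    at-m : ∀ y → ¬ Removed G y₁ y₂ y → at G' (mD y) ≡ map₁ mV (at G y)
    opp-m : ∀ y → ¬ Removed G y₁ y₂ y → opp G' (mD y) ≡ mD (opp G y)
    mult-m : ∀ y → ¬ Removed G y₁ y₂ y → mult G' (mD y) ≡ mult G y
    rot-m : ∀ y → ¬ Removed G y₁ y₂ y → ¬ Removed G y₁ y₂ (rot G y) →
            rot G' (mD y) ≡ mD (rot G y)
    rot-m₁ : ∀ y → ¬ Removed G y₁ y₂ y → rot G y ≡ opp G y₁ →
             rot G' (mD y) ≡ mD (rot G (opp G y₂))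
    rot-m₂ : ∀ y → ¬ Removed G y₁ y₂ y → rot G y ≡ opp G y₂ →
             rot G' (mD y) ≡ mD (rot G (opp G y₁))

-- G and G' related by a square move (possibly followed by contraction
-- moves), or by the inverse of such.

SquareThenContract : ∀ {r n} → HPG r n → HPG r n → Set
SquareThenContract G G' = ∃[ H ] (SquareMove G H × Star Contraction H G')

RelatedBySquareMove : ∀ {r n} → HPG r n → HPG r n → Set
RelatedBySquareMove G G' = SquareThenContract G G' ⊎ SquareThenContract G' G

{-# OPTIONS --safe #-}
-- Trips are compared through a simulation between strand-ends of G and G'.  Both moves keep
-- every dart outside a small region together with its rotation and multiplicity, so a
-- strand-end on a kept dart has a counterpart in G', and at a vertex not touched by the move
-- the i-th turn is the same in both graphs.  At a vertex of the modified region, number its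
-- strand-ends 0, …, r - 1 clockwise: the i-th leftmost (rightmost) turn adds i (r - i) modulo r.
-- A case analysis on where this sum lands shows that the walks in G and G', although they
-- cross the region along different routes, leave it on corresponding strand-ends; hence they
-- end at the same boundary vertex.
module Submission where

open import Defs
open import Data.Nat using (ℕ; zero; suc; _+_; _∸_; _≤_; _<_; s≤s; z≤n; s≤s⁻¹; >-nonZero)
open import Data.Nat.Properties hiding (_≟_; suc-injective)
open import Data.Nat.Induction using (<-rec)
open import Data.Nat.Tactic.RingSolver using (solve-∀; solve)
open import Data.List using (_∷_; [])
open import Data.Bool using (if_then_else_)
open import Data.Fin using (Fin; zero; suc; _≟_)
open import Data.Fin.Properties using (suc-injective)
open import Data.Sum using (_⊎_; inj₁; inj₂; map₁; map₂)
open import Data.Sum.Properties using (≡-dec; inj₁-injective)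
open import Data.Product using (Σ; ∃; ∃-syntax; _×_; _,_; proj₁; proj₂)
open import Data.Empty using (⊥-elim)
open import Function using (_∘_)
open import Function.Bundles using (_⇔_; mk⇔)
open import Function.Construct.Composition using (_⇔-∘_)
open import Function.Construct.Identity using (⇔-id)
open import Function.Construct.Symmetry using (⇔-sym)
open import Relation.Nullary using (¬_; yes; no; Dec)
open import Relation.Nullary.Decidable using (⌊_⌋)
open import Relation.Unary using (Decidable)
open import Relation.Binary.PropositionalEquality
open import Relation.Binary.Construct.Closure.ReflexiveTransitive using (Star; ε; _◅_)

iter-+ : ∀ {A : Set} (f : A → A) m n x → iter f (m + n) x ≡ iter f m (iter f n x)
iter-+ f zero    n x = refl
iter-+ f (suc m) n x = cong f (iter-+ f m n x)

iter-suc : ∀ {A : Set} (f : A → A) k x → iter f k (f x) ≡ iter f (suc k) x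
iter-suc f zero    x = refl
iter-suc f (suc k) x = cong f (iter-suc f k x)

iter-preserves : ∀ {A : Set} (P : A → Set) (f : A → A) → (∀ a → P a → P (f a)) →
                 ∀ k {a} → P a → P (iter f k a)
iter-preserves P f pres zero    pa = pa
iter-preserves P f pres (suc k) pa = pres _ (iter-preserves P f pres k pa)

iter-simulates : ∀ {A B : Set} (P : A → Set) (_~_ : A → B → Set) (f : A → A) (g : B → B) →
                 (∀ a → P a → P (f a)) → (∀ {a b} → P a → a ~ b → f a ~ g b) →
                 ∀ k {a b} → P a → a ~ b → iter f k a ~ iter g k b
iter-simulates P _~_ f g pres sim zero    pa a~b = a~b
iter-simulates P _~_ f g pres sim (suc k) pa a~b =
  sim (iter-preserves P f pres k pa) (iter-simulates P _~_ f g pres sim k pa a~b)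

least-witness : ∀ {P : ℕ → Set} → Decidable P → ∀ {k} → P k →
                ∃[ m ] P m × (∀ {t} → t < m → ¬ P t)
least-witness {P} P? {k} = <-rec Minimisable search k
  where
  Minimisable : ℕ → Set
  Minimisable k = P k → ∃[ m ] P m × (∀ {t} → t < m → ¬ P t)
  search : ∀ k → (∀ {t} → t < k → Minimisable t) → Minimisable k
  search k smaller Pk with anyUpTo? P? k
  ... | yes (t , t<k , Pt) = smaller t<k Pt
  ... | no none            = k , Pk , λ t<k Pt → none (_ , t<k , Pt)

sumBelow : ℕ → (ℕ → ℕ) → ℕ
sumBelow zero    f = 0
sumBelow (suc d) f = sumBelow d f + f d

sumBelow-cong : ∀ d {f g : ℕ → ℕ} → (∀ {t} → t < d → f t ≡ g t) → sumBelow d f ≡ sumBelow d g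
sumBelow-cong zero    f≗g = refl
sumBelow-cong (suc d) f≗g = cong₂ _+_ (sumBelow-cong d (f≗g ∘ m≤n⇒m≤1+n)) (f≗g ≤-refl)

sumBelow-mono : ∀ f {d d'} → d ≤ d' → sumBelow d f ≤ sumBelow d' f
sumBelow-mono f {d} {d'} d≤d' with m≤n⇒∃[o]m+o≡n d≤d'
... | k , refl = go k
  where
  go : ∀ k → sumBelow d f ≤ sumBelow (d + k) f
  go zero    = ≤-reflexive (cong (λ t → sumBelow t f) (sym (+-identityʳ d)))
  go (suc k) = ≤-trans (go k) (subst (sumBelow (d + k) f ≤_)
                 (cong (λ t → sumBelow t f) (sym (+-suc d k))) (m≤m+n _ _))

sumFin-cong : ∀ {N} {f g : Fin N → ℕ} → (∀ x → f x ≡ g x) → sumFin f ≡ sumFin g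
sumFin-cong {zero}  f≗g = refl
sumFin-cong {suc N} f≗g = cong₂ _+_ (f≗g zero) (sumFin-cong (f≗g ∘ suc))

sumFin-zero : ∀ {N} (f : Fin N → ℕ) → (∀ x → f x ≡ 0) → sumFin f ≡ 0
sumFin-zero {zero}  f f≗0 = refl
sumFin-zero {suc N} f f≗0 = cong₂ _+_ (f≗0 zero) (sumFin-zero (f ∘ suc) (f≗0 ∘ suc))

sumFin-remove : ∀ {N} (h h' : Fin N → ℕ) (a : Fin N) → h' a ≡ 0 →
                (∀ w → w ≢ a → h' w ≡ h w) → sumFin h ≡ h a + sumFin h'
sumFin-remove {suc N} h h' zero h'a≡0 h'≗h = begin
    h zero + sumFin (h ∘ suc)
  ≡⟨ cong (h zero +_) (sumFin-cong (λ w → sym (h'≗h (suc w) λ ()))) ⟩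
    h zero + sumFin (h' ∘ suc)
  ≡⟨ cong (λ u → h zero + (u + sumFin (h' ∘ suc))) (sym h'a≡0) ⟩
    h zero + (h' zero + sumFin (h' ∘ suc)) ∎
  where open ≡-Reasoning
sumFin-remove {suc N} h h' (suc a) h'a≡0 h'≗h = begin
    h zero + sumFin (h ∘ suc)
  ≡⟨ cong (h zero +_) (sumFin-remove (h ∘ suc) (h' ∘ suc) a h'a≡0
       (λ w w≢a → h'≗h (suc w) (w≢a ∘ suc-injective))) ⟩
    h zero + (h (suc a) + sumFin (h' ∘ suc))
  ≡⟨ exchange (h zero) (h (suc a)) (sumFin (h' ∘ suc)) ⟩
    h (suc a) + (h zero + sumFin (h' ∘ suc))
  ≡⟨ cong (λ u → h (suc a) + (u + sumFin (h' ∘ suc))) (sym (h'≗h zero λ ())) ⟩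
    h (suc a) + (h' zero + sumFin (h' ∘ suc)) ∎
  where
  open ≡-Reasoning
  exchange : ∀ x y z → x + (y + z) ≡ y + (x + z)
  exchange = solve-∀

zeroAt : ∀ {N} → Fin N → (Fin N → ℕ) → Fin N → ℕ
zeroAt a h w with w ≟ a
... | yes _ = 0
... | no  _ = h w

zeroAt-≡ : ∀ {N} (a : Fin N) h → zeroAt a h a ≡ 0
zeroAt-≡ a h with a ≟ a
... | yes _   = refl
... | no  a≢a = ⊥-elim (a≢a refl)

zeroAt-≢ : ∀ {N} (a : Fin N) h w → w ≢ a → zeroAt a h w ≡ h w
zeroAt-≢ a h w w≢a with w ≟ a
... | yes w≡a = ⊥-elim (w≢a w≡a)
... | no  _   = refl

sumFin-enumerated : ∀ {N} d (z : ℕ → Fin N) (h : Fin N → ℕ) →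
  (∀ {s t} → s < d → t < d → z s ≡ z t → s ≡ t) →
  (∀ w → (∀ {t} → t < d → z t ≢ w) → h w ≡ 0) →
  sumFin h ≡ sumBelow d (h ∘ z)
sumFin-enumerated zero    z h z-inj h-supp = sumFin-zero h (λ w → h-supp w λ ())
sumFin-enumerated (suc d) z h z-inj h-supp = begin
    sumFin h
  ≡⟨ sumFin-remove h h' (z d) (zeroAt-≡ (z d) h) (zeroAt-≢ (z d) h) ⟩
    h (z d) + sumFin h'
  ≡⟨ cong (h (z d) +_) (sumFin-enumerated d z h' (λ s<d t<d → z-inj (m<n⇒m<1+n s<d) (m<n⇒m<1+n t<d)) h'-supp) ⟩
    h (z d) + sumBelow d (h' ∘ z)
  ≡⟨ cong (h (z d) +_) (sumBelow-cong d (λ t<d → zeroAt-≢ (z d) h _ (zt≢zd t<d))) ⟩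
    h (z d) + sumBelow d (h ∘ z)
  ≡⟨ +-comm (h (z d)) _ ⟩
    sumBelow (suc d) (h ∘ z) ∎
  where
  open ≡-Reasoning
  h' = zeroAt (z d) h
  zt≢zd : ∀ {t} → t < d → z t ≢ z d
  zt≢zd t<d zt≡zd = <-irrefl (z-inj (m<n⇒m<1+n t<d) ≤-refl zt≡zd) t<d
  h'-supp : ∀ w → (∀ {t} → t < d → z t ≢ w) → h' w ≡ 0
  h'-supp w missed with w ≟ z d
  ... | yes _    = refl
  ... | no w≢zd  = h-supp w missed'
    where
    missed' : ∀ {t} → t < suc d → z t ≢ w
    missed' {t} t<1+d with m≤n⇒m<n∨m≡n (s≤s⁻¹ t<1+d)
    ... | inj₁ t<d  = missed t<d
    ... | inj₂ refl = w≢zd ∘ sym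

<⊎≥+ : ∀ x y → x < y ⊎ ∃[ k ] y + k ≡ x
<⊎≥+ x y with x <? y
... | yes x<y = inj₁ x<y
... | no  x≮y = inj₂ (m≤n⇒∃[o]m+o≡n (≮⇒≥ x≮y))

-- Linear arithmetic: the hypothesis P ≡ Q, added to the goal, yields an identity of polynomials.
linear : ∀ {L R P Q} → P ≡ Q → L + Q ≡ R + P → L ≡ R
linear {L} {R} {P} refl identity = +-cancelʳ-≡ P L R identity

linear-≤ : ∀ {L R x y P Q} → P ≡ Q → x ≤ y → L + y + Q ≡ R + x + P → L ≤ R
linear-≤ {L} {R} {x} {y} {P} refl x≤y identity =
  +-cancelʳ-≤ x L R (subst (L + x ≤_) (+-cancelʳ-≡ P _ _ identity) (+-monoʳ-≤ L x≤y))

-- The conclusion is spelled suc L ≤ R rather than L < R so that the goal fixes L and R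
-- before the ring solver elaborates the identity.
linear-< : ∀ {L R x y P Q} → P ≡ Q → x < y → L + y + Q ≡ R + x + P → suc L ≤ R
linear-< {L} {R} {x} {y} {P} refl x<y identity =
  +-cancelʳ-< x L R (subst (L + x <_) (+-cancelʳ-≡ P _ _ identity) (+-monoʳ-< L x<y))

if-⌊yes⌋ : ∀ {P : Set} (d : Dec P) → P → ∀ {a b : ℕ} → (if ⌊ d ⌋ then a else b) ≡ a
if-⌊yes⌋ (yes _) _  = refl
if-⌊yes⌋ (no ¬p) p = ⊥-elim (¬p p)

if-⌊no⌋ : ∀ {P : Set} (d : Dec P) → ¬ P → ∀ {a b : ℕ} → (if ⌊ d ⌋ then a else b) ≡ b
if-⌊no⌋ (yes p) ¬p = ⊥-elim (¬p p)
if-⌊no⌋ (no _)  _  = refl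

-- A turn at a vertex of the given colour moves i strand-ends clockwise (white) or
-- counterclockwise (black); around a vertex of degree r the latter is r ∸ i clockwise.
advance : (r i : ℕ) → Color → ℕ
advance r i white = i
advance r i black = r ∸ i

-- Reduction modulo r with at most one wrap-around suffices, since a turn advances by less than r.
Wrap : ℕ → ℕ → ℕ → Set
Wrap r A B = A ≡ B ⊎ A ≡ B + r

flipColor-involutive : ∀ c → flipColor (flipColor c) ≡ c
flipColor-involutive black = refl
flipColor-involutive white = refl

≢⇒flipColor : ∀ {c c'} → c ≢ c' → c' ≡ flipColor c
≢⇒flipColor {black} {black} c≢c' = ⊥-elim (c≢c' refl)
≢⇒flipColor {black} {white} _    = refl
≢⇒flipColor {white} {black} _    = refl
≢⇒flipColor {white} {white} c≢c' = ⊥-elim (c≢c' refl)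

advance-flip : ∀ {r i} → i ≤ r → ∀ c → advance r i c + advance r i (flipColor c) ≡ r
advance-flip {r} {i} i≤r white = trans (+-comm i (r ∸ i)) (m∸n+n≡m i≤r)
advance-flip {r} {i} i≤r black = m∸n+n≡m i≤r

advance-< : ∀ {r i} → 0 < i → i < r → ∀ c → advance r i c < r
advance-< 0<i i<r white = i<r
advance-< 0<i i<r black = ∸-monoʳ-< 0<i (<⇒≤ i<r)

module StrandEnds {r n} (G : HPG r n) where

  strandEnd-≡ : ∀ {x y : Fin (nD G)} {p q} {lp : p < mult G x} {lq : q < mult G y} →
                x ≡ y → p ≡ q → _≡_ {A = StrandEnd G} (x , p , lp) (y , q , lq)
  strandEnd-≡ refl refl = cong (λ l → _ , _ , l) (<-irrelevant _ _)

  first : Fin (nD G) → StrandEnd G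
  first x = x , 0 , mult-pos G x

  cw-iter-first : ∀ x p (p<m : p < mult G x) → iter (cw G) p (first x) ≡ (x , p , p<m)
  cw-iter-first x zero    p<m = strandEnd-≡ refl refl
  cw-iter-first x (suc p) p<m = trans (cong (cw G) (cw-iter-first x p (<-trans (n<1+n p) p<m))) cw-step
    where
    cw-step : cw G (x , p , <-trans (n<1+n p) p<m) ≡ (x , suc p , p<m)
    cw-step with suc p <? mult G x
    ... | yes _   = strandEnd-≡ refl refl
    ... | no  1+p≮m = ⊥-elim (1+p≮m p<m)

  cw-iter-mult : ∀ x → iter (cw G) (mult G x) (first x) ≡ first (rot G x)
  cw-iter-mult x =
    subst (λ m → iter (cw G) m (first x) ≡ first (rot G x)) 1+k≡m
      (trans (cong (cw G) (cw-iter-first x k k<m)) cw-last)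
    where
    k = mult G x ∸ 1
    1+k≡m : suc k ≡ mult G x
    1+k≡m = suc-pred (mult G x) {{>-nonZero (mult-pos G x)}}
    k<m : k < mult G x
    k<m = ≤-reflexive 1+k≡m
    cw-last : cw G (x , k , k<m) ≡ first (rot G x)
    cw-last with suc k <? mult G x
    ... | yes k<k = ⊥-elim (<-irrefl 1+k≡m k<k)
    ... | no  _   = refl

  ccw-cw : ∀ s → ccw G (cw G s) ≡ s
  ccw-cw (x , p , p<m) with suc p <? mult G x
  ... | yes _     = strandEnd-≡ refl refl
  ... | no  1+p≮m = strandEnd-≡ (rot-inv-l G x)
                      (trans (cong (λ y → mult G y ∸ 1) (rot-inv-l G x))
                             (cong (_∸ 1) (≤-antisym (≮⇒≥ 1+p≮m) p<m)))

  ccw-iter-cw : ∀ k s → iter (ccw G) k (iter (cw G) k s) ≡ s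
  ccw-iter-cw zero    s = refl
  ccw-iter-cw (suc k) s = begin
      ccw G (iter (ccw G) k (iter (cw G) (suc k) s))
    ≡⟨ cong (ccw G ∘ iter (ccw G) k) (sym (iter-suc (cw G) k s)) ⟩
      ccw G (iter (ccw G) k (iter (cw G) k (cw G s)))
    ≡⟨ cong (ccw G) (ccw-iter-cw k (cw G s)) ⟩
      ccw G (cw G s)
    ≡⟨ ccw-cw s ⟩
      s ∎
    where open ≡-Reasoning

  at-cw : ∀ s → at G (proj₁ (cw G s)) ≡ at G (proj₁ s)
  at-cw (x , p , _) with suc p <? mult G x
  ... | yes _ = refl
  ... | no  _ = rot-at G x

  at-ccw : ∀ s → at G (proj₁ (ccw G s)) ≡ at G (proj₁ s)
  at-ccw (x , zero  , _) = trans (sym (rot-at G (rot⁻¹ G x))) (cong (at G) (rot-inv-r G x))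
  at-ccw (x , suc p , _) = refl

  AtVertex : Fin (nV G) → StrandEnd G → Set
  AtVertex v s = at G (proj₁ s) ≡ inj₁ v

  cw-stays : ∀ {v} s → AtVertex v s → AtVertex v (cw G s)
  cw-stays s = trans (at-cw s)

  ccw-stays : ∀ {v} s → AtVertex v s → AtVertex v (ccw G s)
  ccw-stays s = trans (at-ccw s)

  iter-rot-injective : ∀ k {x y} → iter (rot G) k x ≡ iter (rot G) k y → x ≡ y
  iter-rot-injective zero    eq = eq
  iter-rot-injective (suc k) eq = iter-rot-injective k (rot-injective eq)
    where
    rot-injective : ∀ {x y} → rot G x ≡ rot G y → x ≡ y
    rot-injective {x} {y} eq =
      trans (sym (rot-inv-l G x)) (trans (cong (rot⁻¹ G) eq) (rot-inv-l G y))

  module Around (v : Fin (nV G)) (y₀ : Fin (nD G)) (y₀-at : at G y₀ ≡ inj₁ v) where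

    dart : ℕ → Fin (nD G)
    dart t = iter (rot G) t y₀

    at-dart : ∀ t → at G (dart t) ≡ inj₁ v
    at-dart zero    = y₀-at
    at-dart (suc t) = trans (rot-at G (dart t)) (at-dart t)

    private
      first-return : ∃[ m ] dart (suc m) ≡ y₀ × (∀ {t} → t < m → dart (suc t) ≢ y₀)
      first-return with rot-cycle G (rot G y₀) y₀ (rot-at G y₀)
      ... | k , eq = least-witness (λ t → dart (suc t) ≟ y₀) {k} (trans (sym (iter-suc (rot G) k y₀)) eq)

    valence : ℕ
    valence = suc (proj₁ first-return)

    dart-valence : dart valence ≡ y₀
    dart-valence = proj₁ (proj₂ first-return)

    private
      no-early-return : ∀ {c} → c < valence → dart c ≡ y₀ → c ≡ 0
      no-early-return {zero}  _          _  = refl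
      no-early-return {suc c} (s≤s c<m) eq = ⊥-elim (proj₂ (proj₂ first-return) c<m eq)

      dart-injective-≤ : ∀ {s t} → s ≤ t → t < valence → dart s ≡ dart t → s ≡ t
      dart-injective-≤ {s} s≤t t<val eq with m≤n⇒∃[o]m+o≡n s≤t
      ... | c , refl = sym (trans (cong (s +_) c≡0) (+-identityʳ s))
        where
        c≡0 : c ≡ 0
        c≡0 = no-early-return (≤-<-trans (m≤n+m c s) t<val)
                (sym (iter-rot-injective s (trans eq (iter-+ (rot G) s c y₀))))

    dart-injective : ∀ {s t} → s < valence → t < valence → dart s ≡ dart t → s ≡ t
    dart-injective {s} {t} s<val t<val eq with ≤-total s t
    ... | inj₁ s≤t = dart-injective-≤ s≤t t<val eq
    ... | inj₂ t≤s = sym (dart-injective-≤ t≤s s<val (sym eq))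

    dart-reduce : ∀ k → ∃[ t ] t < valence × dart t ≡ dart k
    dart-reduce zero = 0 , s≤s z≤n , refl
    dart-reduce (suc k) with dart-reduce k
    ... | t , t<val , eq with m≤n⇒m<n∨m≡n t<val
    ...   | inj₁ 1+t<val = suc t , 1+t<val , cong (rot G) eq
    ...   | inj₂ 1+t≡val =
            0 , s≤s z≤n , trans (sym dart-valence) (trans (cong dart (sym 1+t≡val)) (cong (rot G) eq))

    dart-surjective : ∀ y → at G y ≡ inj₁ v → ∃[ t ] t < valence × dart t ≡ y
    dart-surjective y y-at with rot-cycle G y₀ y (trans y₀-at (sym y-at))
    ... | k , eq with dart-reduce k
    ...   | t , t<val , eq' = t , t<val , trans eq' eq

    offset : ℕ → ℕ
    offset t = sumBelow t (mult G ∘ dart)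

    offset-valence : offset valence ≡ r
    offset-valence = begin
        offset valence
      ≡⟨ sumBelow-cong valence (λ {t} _ → sym (if-⌊yes⌋ (incident? (dart t)) (at-dart t))) ⟩
        sumBelow valence (summand ∘ dart)
      ≡⟨ sym (sumFin-enumerated valence dart summand dart-injective off-darts) ⟩
        sumFin summand
      ≡⟨ degree G v ⟩
        r ∎
      where
      open ≡-Reasoning
      incident? : ∀ x → Dec (at G x ≡ inj₁ v)
      incident? x = ≡-dec _≟_ _≟_ (at G x) (inj₁ v)
      summand : Fin (nD G) → ℕ
      summand x = if ⌊ incident? x ⌋ then mult G x else 0
      off-darts : ∀ x → (∀ {t} → t < valence → dart t ≢ x) → summand x ≡ 0
      off-darts x missed = if-⌊no⌋ (incident? x) λ x-at →
        let (t , t<val , eq) = dart-surjective x x-at in missed t<val eq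

    pos : ℕ → StrandEnd G
    pos T = iter (cw G) T (first y₀)

    pos-+ : ∀ T k → pos (T + k) ≡ iter (cw G) k (pos T)
    pos-+ T k = trans (cong (λ u → iter (cw G) u (first y₀)) (+-comm T k)) (iter-+ (cw G) k T (first y₀))

    at-pos : ∀ T → AtVertex v (pos T)
    at-pos T = iter-preserves (AtVertex v) (cw G) cw-stays T y₀-at

    pos-offset : ∀ t p (p<m : p < mult G (dart t)) → pos (offset t + p) ≡ (dart t , p , p<m)
    pos-offset zero    p p<m = cw-iter-first y₀ p p<m
    pos-offset (suc t) p p<m = begin
        pos (offset t + mult G (dart t) + p)
      ≡⟨ pos-+ (offset t + mult G (dart t)) p ⟩
        iter (cw G) p (pos (offset t + mult G (dart t)))
      ≡⟨ cong (iter (cw G) p) (pos-+ (offset t) _) ⟩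
        iter (cw G) p (iter (cw G) (mult G (dart t)) (pos (offset t)))
      ≡⟨ cong (iter (cw G) p ∘ iter (cw G) (mult G (dart t))) pos-offset-first ⟩
        iter (cw G) p (iter (cw G) (mult G (dart t)) (first (dart t)))
      ≡⟨ cong (iter (cw G) p) (cw-iter-mult (dart t)) ⟩
        iter (cw G) p (first (dart (suc t)))
      ≡⟨ cw-iter-first (dart (suc t)) p p<m ⟩
        (dart (suc t) , p , p<m) ∎
      where
      open ≡-Reasoning
      pos-offset-first : pos (offset t) ≡ first (dart t)
      pos-offset-first =
        trans (cong pos (sym (+-identityʳ (offset t)))) (pos-offset t 0 (mult-pos G (dart t)))

    pos-r : pos r ≡ first y₀
    pos-r = begin
        pos r
      ≡⟨ cong pos (sym (trans (+-identityʳ _) offset-valence)) ⟩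
        pos (offset valence + 0)
      ≡⟨ pos-offset valence 0 (mult-pos G (dart valence)) ⟩
        first (dart valence)
      ≡⟨ strandEnd-≡ dart-valence refl ⟩
        first y₀ ∎
      where open ≡-Reasoning

    pos-+r : ∀ T → pos (T + r) ≡ pos T
    pos-+r T = trans (iter-+ (cw G) T r (first y₀)) (cong (iter (cw G) T) pos-r)

    pos-wrap : ∀ {A B} → Wrap r A B → pos A ≡ pos B
    pos-wrap (inj₁ A≡B)           = cong pos A≡B
    pos-wrap {B = B} (inj₂ A≡B+r) = trans (cong pos A≡B+r) (pos-+r B)

    turn-pos : ∀ {i} → i ≤ r → ∀ c T → turn G c i (pos T) ≡ pos (T + advance r i c)
    turn-pos {i} i≤r white T = sym (pos-+ T i)
    turn-pos {i} i≤r black T = begin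
        iter (ccw G) i (pos T)
      ≡⟨ cong (iter (ccw G) i) (sym (pos-+r T)) ⟩
        iter (ccw G) i (pos (T + r))
      ≡⟨ cong (iter (ccw G) i ∘ pos) T+r≡T+[r∸i]+i ⟩
        iter (ccw G) i (pos (T + (r ∸ i) + i))
      ≡⟨ cong (iter (ccw G) i) (pos-+ (T + (r ∸ i)) i) ⟩
        iter (ccw G) i (iter (cw G) i (pos (T + (r ∸ i))))
      ≡⟨ ccw-iter-cw i _ ⟩
        pos (T + (r ∸ i)) ∎
      where
      open ≡-Reasoning
      T+r≡T+[r∸i]+i : T + r ≡ T + (r ∸ i) + i
      T+r≡T+[r∸i]+i = trans (cong (T +_) (sym (m∸n+n≡m i≤r))) (sym (+-assoc T (r ∸ i) i))

    pos-surjective : ∀ s → AtVertex v s → ∃[ e ] e < r × pos e ≡ s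
    pos-surjective (y , p , p<m) y-at with dart-surjective y y-at
    ... | t , t<val , refl = offset t + p , bound , pos-offset t p p<m
      where
      bound : offset t + p < r
      bound = subst (offset t + p <_) offset-valence
                (<-≤-trans (+-monoʳ-< (offset t) p<m) (sumBelow-mono (mult G ∘ dart) t<val))

    private
      split-offset : ∀ s e → e < offset s →
                     ∃[ t ] t < s × ∃[ p ] p < mult G (dart t) × e ≡ offset t + p
      split-offset (suc s) e e<o with e <? offset s
      ... | yes e<os = let (t , t<s , rest) = split-offset s e e<os in t , m≤n⇒m≤1+n t<s , rest
      ... | no  e≮os = let (p , eq) = m≤n⇒∃[o]m+o≡n (≮⇒≥ e≮os) in
            s , ≤-refl , p , +-cancelˡ-< (offset s) p _ (subst (_< offset (suc s)) (sym eq) e<o) , sym eq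

    pos-injective : ∀ {e e'} → e < r → e' < r → pos e ≡ pos e' → e ≡ e'
    pos-injective {e} {e'} e<r e'<r eq
      with split-offset valence e (subst (e <_) (sym offset-valence) e<r)
         | split-offset valence e' (subst (e' <_) (sym offset-valence) e'<r)
    ... | t , t<val , p , p<m , refl | t' , t'<val , p' , p'<m , refl =
          cong₂ (λ t p → offset t + p) (dart-injective t<val t'<val (cong proj₁ same))
                                       (cong (proj₁ ∘ proj₂) same)
      where
      same : (dart t , p , p<m) ≡ (dart t' , p' , p'<m)
      same = trans (sym (pos-offset t p p<m)) (trans eq (pos-offset t' p' p'<m))

module Walks {r n} (G : HPG r n) (i : ℕ) where

  next : Fin (nV G) → StrandEnd G → StrandEnd G
  next v s = cross G (turn G (color G v) i s)

  data _↝_ : StrandEnd G → StrandEnd G → Set where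
    [_] : ∀ {s v} → at G (proj₁ s) ≡ inj₁ v → s ↝ next v s
    _∷_ : ∀ {s v t} → at G (proj₁ s) ≡ inj₁ v → next v s ↝ t → s ↝ t

  infixr 5 _∷_

  via : ∀ {s v t u} → at G (proj₁ s) ≡ inj₁ v → next v s ≡ t → t ↝ u → s ↝ u
  via s-at refl t↝u = s-at ∷ t↝u

  length : ∀ {s k} → Reaches G i s k → ℕ
  length (done _)   = 0
  length (step _ d) = suc (length d)

  ↝-reaches : ∀ {s t k} → s ↝ t → Reaches G i t k → Reaches G i s k
  ↝-reaches [ s-at ]      d = step s-at d
  ↝-reaches (s-at ∷ s↝t) d = step s-at (↝-reaches s↝t d)

  reaches-↝ : ∀ {s t k} → s ↝ t → (d : Reaches G i s k) →
              Σ (Reaches G i t k) λ d' → length d' < length d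
  reaches-↝ [ s-at ] (done s-bd) with trans (sym s-at) s-bd
  ... | ()
  reaches-↝ [ s-at ] (step s-at' d) with trans (sym s-at) s-at'
  ... | refl = d , ≤-refl
  reaches-↝ (s-at ∷ _) (done s-bd) with trans (sym s-at) s-bd
  ... | ()
  reaches-↝ (s-at ∷ s↝t) (step s-at' d) with trans (sym s-at) s-at'
  ... | refl = let (d' , shorter) = reaches-↝ s↝t d in d' , m<n⇒m<1+n shorter

Rejoin : ∀ {r n} {G G' : HPG r n} (i : ℕ) → (StrandEnd G → StrandEnd G' → Set) →
         StrandEnd G → StrandEnd G' → Set
Rejoin {G = G} {G'} i _∼_ s s' =
  ∃[ t ] ∃[ t' ] Walks._↝_ G i s t × Walks._↝_ G' i s' t' × t ∼ t'

module Simulation {r n} {G G' : HPG r n} (i : ℕ)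
  (_∼_ : StrandEnd G → StrandEnd G' → Set)
  (exits→ : ∀ {s s' k} → s ∼ s' → at G (proj₁ s) ≡ inj₂ k → at G' (proj₁ s') ≡ inj₂ k)
  (exits← : ∀ {s s' k} → s ∼ s' → at G' (proj₁ s') ≡ inj₂ k → at G (proj₁ s) ≡ inj₂ k)
  (rejoin : ∀ {s s' v} → s ∼ s' → at G (proj₁ s) ≡ inj₁ v → Rejoin {G = G} {G'} i _∼_ s s')
  where

  private
    module W  = Walks G i
    module W' = Walks G' i

    forward : ∀ N {s s' k} → s ∼ s' → (d : Reaches G i s k) → W.length d ≤ N → Reaches G' i s' k
    forward N       s∼s' (done s-bd) _ = done (exits→ s∼s' s-bd)
    forward (suc N) s∼s' (step s-at d) (s≤s len≤N) with rejoin s∼s' s-at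
    ... | t , t' , s↝t , s'↝t' , t∼t' with W.reaches-↝ s↝t (step s-at d)
    ...   | d' , shorter = W'.↝-reaches s'↝t' (forward N t∼t' d' (≤-trans (s≤s⁻¹ shorter) len≤N))

    backward : ∀ N {s s' k} → s ∼ s' → (d : Reaches G' i s' k) → W'.length d ≤ N → Reaches G i s k
    backward N s∼s' (done s'-bd) _ = done (exits← s∼s' s'-bd)
    backward (suc N) {s} s∼s' (step s'-at d) (s≤s len≤N) with at G (proj₁ s) in s-at
    ... | inj₂ _ with trans (sym s'-at) (exits→ s∼s' s-at)
    ...   | ()
    backward (suc N) {s} s∼s' (step s'-at d) (s≤s len≤N) | inj₁ _ with rejoin s∼s' s-at
    ...   | t , t' , s↝t , s'↝t' , t∼t' with W'.reaches-↝ s'↝t' (step s'-at d)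
    ...     | d' , shorter = W.↝-reaches s↝t (backward N t∼t' d' (≤-trans (s≤s⁻¹ shorter) len≤N))

  reaches⇔ : ∀ {s s' k} → s ∼ s' → Reaches G i s k ⇔ Reaches G' i s' k
  reaches⇔ s∼s' = mk⇔ (λ d → forward _ s∼s' d ≤-refl) (λ d → backward _ s∼s' d ≤-refl)

-- Both moves keep every dart outside a small region (`Changed`) and its rotation data.
record DartEmbedding {r n} (G G' : HPG r n) : Set₁ where
  field
    Changed : Fin (nD G) → Set
    vmap : Fin (nV G) → Fin (nV G')
    dmap : Fin (nD G) → Fin (nD G')
    changed-opp : ∀ y → Changed (opp G y) → Changed y
    bd-unchanged : ∀ j → ¬ Changed (bd G j)
    at-dmap : ∀ y → ¬ Changed y → at G' (dmap y) ≡ map₁ vmap (at G y)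
    opp-dmap : ∀ y → ¬ Changed y → opp G' (dmap y) ≡ dmap (opp G y)
    mult-dmap : ∀ y → ¬ Changed y → mult G' (dmap y) ≡ mult G y
    rot-dmap : ∀ y → ¬ Changed y → ¬ Changed (rot G y) → rot G' (dmap y) ≡ dmap (rot G y)

module Embedding {r n} {G G' : HPG r n} (E : DartEmbedding G G') (i : ℕ) where
  open DartEmbedding E
  open StrandEnds G using (AtVertex; first; cw-stays; ccw-stays)
  open StrandEnds G' using (strandEnd-≡) renaming (first to first')
  open Walks G i using ([_]; next)
  open Walks G' i using () renaming ([_] to [_]')

  record _∼_ (s : StrandEnd G) (s' : StrandEnd G') : Set where
    constructor corr
    field
      unchanged : ¬ Changed (proj₁ s)
      dart-≡    : proj₁ s' ≡ dmap (proj₁ s)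
      strand-≡  : proj₁ (proj₂ s') ≡ proj₁ (proj₂ s)

  open _∼_ public

  ∼-functional : ∀ {s s₁ s₂} → s ∼ s₁ → s ∼ s₂ → s₁ ≡ s₂
  ∼-functional {_} {_ , _ , _} {_ , _ , _} (corr _ d₁ p₁) (corr _ d₂ p₂) =
    strandEnd-≡ (trans d₁ (sym d₂)) (trans p₁ (sym p₂))

  ∼-subst : ∀ {s₁ s₂ s₁' s₂'} → s₁ ≡ s₂ → s₁' ≡ s₂' → s₁ ∼ s₁' → s₂ ∼ s₂'
  ∼-subst refl refl s∼s' = s∼s'

  cross-∼ : ∀ {s s'} → s ∼ s' → cross G s ∼ cross G' s'
  cross-∼ {y , _ , _} {_ , _ , _} (corr y-kept refl refl) =
    corr (y-kept ∘ changed-opp y) (opp-dmap y y-kept) refl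

  cw-∼ : ∀ {s s'} → s ∼ s' → ¬ Changed (proj₁ (cw G s)) → cw G s ∼ cw G' s'
  cw-∼ {y , p , _} {_ , _ , _} (corr y-kept refl refl) cw-kept
    with suc p <? mult G y | suc p <? mult G' (dmap y)
  ... | yes _    | yes _    = corr y-kept refl refl
  ... | yes 1+p< | no  1+p≮ = ⊥-elim (1+p≮ (subst (suc p <_) (sym (mult-dmap y y-kept)) 1+p<))
  ... | no  1+p≮ | yes 1+p< = ⊥-elim (1+p≮ (subst (suc p <_) (mult-dmap y y-kept) 1+p<))
  ... | no  _    | no  _    = corr cw-kept (rot-dmap y y-kept cw-kept) refl

  rot⁻¹-dmap : ∀ y → ¬ Changed y → ¬ Changed (rot⁻¹ G y) → rot⁻¹ G' (dmap y) ≡ dmap (rot⁻¹ G y)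
  rot⁻¹-dmap y y-kept y⁻-kept = begin
      rot⁻¹ G' (dmap y)
    ≡⟨ cong (rot⁻¹ G' ∘ dmap) (sym (rot-inv-r G y)) ⟩
      rot⁻¹ G' (dmap (rot G (rot⁻¹ G y)))
    ≡⟨ cong (rot⁻¹ G') (sym (rot-dmap (rot⁻¹ G y) y⁻-kept
                               (subst (¬_ ∘ Changed) (sym (rot-inv-r G y)) y-kept))) ⟩
      rot⁻¹ G' (rot G' (dmap (rot⁻¹ G y)))
    ≡⟨ rot-inv-l G' _ ⟩
      dmap (rot⁻¹ G y) ∎
    where open ≡-Reasoning

  ccw-∼ : ∀ {s s'} → s ∼ s' → ¬ Changed (proj₁ (ccw G s)) → ccw G s ∼ ccw G' s'
  ccw-∼ {y , zero , _} {_ , _ , _} (corr y-kept refl refl) ccw-kept =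
    corr ccw-kept (rot⁻¹-dmap y y-kept ccw-kept)
      (cong (_∸ 1) (trans (cong (mult G') (rot⁻¹-dmap y y-kept ccw-kept)) (mult-dmap _ ccw-kept)))
  ccw-∼ {y , suc p , _} {_ , _ , _} (corr y-kept refl refl) _ = corr y-kept refl refl

  at-∼ : ∀ {s s' v} → s ∼ s' → at G (proj₁ s) ≡ inj₁ v → at G' (proj₁ s') ≡ inj₁ (vmap v)
  at-∼ {y , _ , _} {_ , _ , _} (corr y-kept refl _) s-at = trans (at-dmap y y-kept) (cong (map₁ vmap) s-at)

  exits→ : ∀ {s s' k} → s ∼ s' → at G (proj₁ s) ≡ inj₂ k → at G' (proj₁ s') ≡ inj₂ k
  exits→ {y , _ , _} {_ , _ , _} (corr y-kept refl _) s-bd = trans (at-dmap y y-kept) (cong (map₁ vmap) s-bd)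

  exits← : ∀ {s s' k} → s ∼ s' → at G' (proj₁ s') ≡ inj₂ k → at G (proj₁ s) ≡ inj₂ k
  exits← {y , _ , _} {_ , _ , _} (corr y-kept refl _) s'-bd with at G y | at-dmap y y-kept
  ... | inj₁ _ | eq with trans (sym eq) s'-bd
  ...   | ()
  exits← {y , _ , _} {_ , _ , _} (corr y-kept refl _) s'-bd | inj₂ _ | eq with trans (sym eq) s'-bd
  ...   | refl = refl

  start-∼ : ∀ j → cross G (first (bd G j)) ∼ cross G' (first' (bd G' j))
  start-∼ j = cross-∼ (corr (bd-unchanged j) (sym (bd-unique G' (dmap (bd G j)) j dmap-at)) refl)
    where
    dmap-at : at G' (dmap (bd G j)) ≡ inj₂ j
    dmap-at = trans (at-dmap (bd G j) (bd-unchanged j)) (cong (map₁ vmap) (bd-at G j))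

  Rejoins : StrandEnd G → StrandEnd G' → Set
  Rejoins = Rejoin {G = G} {G'} i _∼_

  Untouched : Fin (nV G) → Set
  Untouched v = ∀ y → at G y ≡ inj₁ v → ¬ Changed y

  rejoin-untouched : ∀ {v s s'} → Untouched v → color G' (vmap v) ≡ color G v →
                     s ∼ s' → at G (proj₁ s) ≡ inj₁ v → Rejoins s s'
  rejoin-untouched {v} {s} {s'} v-untouched same-color s∼s' s-at =
    _ , _ , [ s-at ] , [ at-∼ s∼s' s-at ]' ,
    subst (λ c → next v s ∼ cross G' (turn G' c i s')) (sym same-color)
      (cross-∼ (turn-∼ (color G v) s-at s∼s'))
    where
    turn-∼ : ∀ c {s s'} → AtVertex v s → s ∼ s' → turn G c i s ∼ turn G' c i s'
    turn-∼ white = iter-simulates (AtVertex v) _∼_ (cw G) (cw G') cw-stays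
      (λ {s} s-at s∼s' → cw-∼ s∼s' (v-untouched _ (cw-stays s s-at))) i
    turn-∼ black = iter-simulates (AtVertex v) _∼_ (ccw G) (ccw G') ccw-stays
      (λ {s} s-at s∼s' → ccw-∼ s∼s' (v-untouched _ (ccw-stays s s-at))) i

  trip⇔ : (∀ {s s' v} → s ∼ s' → at G (proj₁ s) ≡ inj₁ v → Rejoins s s') →
          ∀ j k → Trip G i j k ⇔ Trip G' i j k
  trip⇔ rejoin j k = reaches⇔ (start-∼ j)
    where open Simulation i _∼_ exits→ exits← rejoin

-- Positions around a corner v_j of the face, counted clockwise from its edge e_j:
-- [0, a) on e_j, [a, a + d) on e_{j-1}, [a + d, r) outside the face, where a, b, c, d
-- are the multiplicities of e_j, e_{j+1}, e_{j+2}, e_{j-1}.  A strand entering at a + d + o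
-- is turned by α (β at the corners of the other colour) and lands at a + d + o + α mod r.
module CornerArithmetic (a b c d r α β : ℕ) (abcd≡r : a + b + c + d ≡ r) (αβ≡r : α + β ≡ r) where

  entering-range : ∀ {o} → a + d + o < r → o < b + c
  entering-range {o} e<r = linear-< (sym abcd≡r) e<r (solve (a ∷ b ∷ c ∷ d ∷ r ∷ o ∷ []))

  direct-exit<r : ∀ {o} → o + α < b + c → a + d + o + α < r
  direct-exit<r {o} lt = linear-< abcd≡r lt (solve (a ∷ b ∷ c ∷ d ∷ r ∷ α ∷ o ∷ []))

  module ViaNext {o d'} (E : b + c + d' ≡ o + α) where
    lands : a + d + o + α ≡ d' + r
    lands = linear (cong₂ _+_ (sym E) abcd≡r) (solve (a ∷ b ∷ c ∷ d ∷ r ∷ α ∷ o ∷ d' ∷ []))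

    turn-at-w : d' + β ≡ d + a + o
    turn-at-w = linear (cong₂ _+_ E (cong₂ _+_ αβ≡r (sym abcd≡r)))
                  (solve (a ∷ b ∷ c ∷ d ∷ r ∷ α ∷ β ∷ o ∷ d' ∷ []))

    turn-at-w₁ : a + b + d + o + α ≡ b + d' + r
    turn-at-w₁ = linear (cong₂ _+_ (sym E) abcd≡r) (solve (a ∷ b ∷ c ∷ d ∷ r ∷ α ∷ o ∷ d' ∷ []))

    turn-at-v₁ : b + d' + β ≡ b + (d + a + o)
    turn-at-v₁ = trans (+-assoc b d' β) (cong (b +_) turn-at-w)

    exit<r : o < c → b + (d + a + o) < r
    exit<r o<c = linear-< abcd≡r o<c (solve (a ∷ b ∷ c ∷ d ∷ r ∷ o ∷ []))

  module ViaNextTwo {o' d'} (E : b + c + d' ≡ c + o' + α) where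
    lands : a + d + (c + o') + α ≡ d' + r
    lands = linear (cong₂ _+_ (sym E) abcd≡r) (solve (a ∷ b ∷ c ∷ d ∷ r ∷ α ∷ o' ∷ d' ∷ []))

    turn-at-w : d' + β ≡ d + a + c + o'
    turn-at-w = linear (cong₂ _+_ E (cong₂ _+_ αβ≡r (sym abcd≡r)))
                  (solve (a ∷ b ∷ c ∷ d ∷ r ∷ α ∷ β ∷ o' ∷ d' ∷ []))

    turn-at-w₃ : c + d + o' + α ≡ c + d + b + d'
    turn-at-w₃ = linear (sym E) (solve (b ∷ c ∷ d ∷ α ∷ o' ∷ d' ∷ []))

    turn-at-w₂ : b + c + d' + β ≡ c + o' + r
    turn-at-w₂ = linear (cong₂ _+_ E αβ≡r) (solve (b ∷ c ∷ r ∷ α ∷ β ∷ o' ∷ d' ∷ []))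

    turn-at-v₁ : b + d' + β ≡ o' + r
    turn-at-v₁ = linear (cong₂ _+_ E αβ≡r) (solve (b ∷ c ∷ r ∷ α ∷ β ∷ o' ∷ d' ∷ []))

    turn-at-v₂ : c + o' + α ≡ c + b + d'
    turn-at-v₂ = linear (sym E) (solve (b ∷ c ∷ α ∷ o' ∷ d' ∷ []))

    exit<r : d' < a → c + b + d' < r
    exit<r d'<a = <-≤-trans (+-monoʳ-< (c + b) d'<a) c+b+a≤r
      where
      c+b+a≤r : c + b + a ≤ r
      c+b+a≤r = linear-≤ abcd≡r (z≤n {d}) (solve (a ∷ b ∷ c ∷ d ∷ r ∷ []))

  module ViaPrevTwo {o q} (E : b + c + (a + q) ≡ o + α) where
    lands : a + d + o + α ≡ a + q + r
    lands = linear (cong₂ _+_ (sym E) abcd≡r) (solve (a ∷ b ∷ c ∷ d ∷ r ∷ α ∷ o ∷ q ∷ []))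

    turn-at-v₃ : q + β ≡ d + o
    turn-at-v₃ = linear (cong₂ _+_ E (cong₂ _+_ αβ≡r (sym abcd≡r)))
                   (solve (a ∷ b ∷ c ∷ d ∷ r ∷ α ∷ β ∷ o ∷ q ∷ []))

    turn-at-v₂ : o + α ≡ c + b + (a + q)
    turn-at-v₂ = linear (sym E) (solve (a ∷ b ∷ c ∷ α ∷ o ∷ q ∷ []))

    exit<r : q < d → c + b + (a + q) < r
    exit<r q<d = linear-< abcd≡r q<d (solve (a ∷ b ∷ c ∷ d ∷ r ∷ q ∷ []))

    turn-at-w : a + q + β ≡ d + a + o
    turn-at-w = linear (cong₂ _+_ E (cong₂ _+_ αβ≡r (sym abcd≡r)))
                  (solve (a ∷ b ∷ c ∷ d ∷ r ∷ α ∷ β ∷ o ∷ q ∷ []))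

    turn-at-w₁ : a + b + d + o + α ≡ a + b + q + r
    turn-at-w₁ = linear (cong₂ _+_ (sym E) abcd≡r) (solve (a ∷ b ∷ c ∷ d ∷ r ∷ α ∷ o ∷ q ∷ []))

    turn-at-w₂ : b + c + a + q + β ≡ o + r
    turn-at-w₂ = linear (cong₂ _+_ E αβ≡r) (solve (a ∷ b ∷ c ∷ r ∷ α ∷ β ∷ o ∷ q ∷ []))

  module ViaPrev {o'' q} (E : b + c + (a + q) ≡ c + o'' + α) where
    lands : a + d + (c + o'') + α ≡ a + q + r
    lands = linear (cong₂ _+_ (sym E) abcd≡r) (solve (a ∷ b ∷ c ∷ d ∷ r ∷ α ∷ o'' ∷ q ∷ []))

    turn-at-v₃ : q + β ≡ d + c + o''
    turn-at-v₃ = linear (cong₂ _+_ E (cong₂ _+_ αβ≡r (sym abcd≡r)))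
                   (solve (a ∷ b ∷ c ∷ d ∷ r ∷ α ∷ β ∷ o'' ∷ q ∷ []))

    exit<r : o'' < b → d + c + o'' < r
    exit<r o''<b = <-≤-trans (+-monoʳ-< (d + c) o''<b) d+c+b≤r
      where
      d+c+b≤r : d + c + b ≤ r
      d+c+b≤r = linear-≤ abcd≡r (z≤n {a}) (solve (a ∷ b ∷ c ∷ d ∷ r ∷ []))

    turn-at-w : a + q + β ≡ d + a + c + o''
    turn-at-w = linear (cong₂ _+_ E (cong₂ _+_ αβ≡r (sym abcd≡r)))
                  (solve (a ∷ b ∷ c ∷ d ∷ r ∷ α ∷ β ∷ o'' ∷ q ∷ []))

    turn-at-w₃ : c + d + o'' + α ≡ q + r
    turn-at-w₃ = linear (cong₂ _+_ (sym E) abcd≡r) (solve (a ∷ b ∷ c ∷ d ∷ r ∷ α ∷ o'' ∷ q ∷ []))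

  module Wrapped {o o₂} (E : b + c + (a + (d + o₂)) ≡ o + α) where
    lands : a + d + o + α ≡ a + d + o₂ + r
    lands = linear (cong₂ _+_ (sym E) abcd≡r) (solve (a ∷ b ∷ c ∷ d ∷ r ∷ α ∷ o ∷ o₂ ∷ []))

    exit<r : o < b + c → α < r → a + d + o₂ < r
    exit<r o<b+c α<r = linear-< E (+-mono-< o<b+c α<r) (solve (a ∷ b ∷ c ∷ d ∷ r ∷ α ∷ o ∷ o₂ ∷ []))

nx-pv : ∀ k → nx (pv k) ≡ k
nx-pv zero                   = refl
nx-pv (suc zero)             = refl
nx-pv (suc (suc zero))       = refl
nx-pv (suc (suc (suc zero))) = refl

pv-nx : ∀ k → pv (nx k) ≡ k
pv-nx zero                   = refl
pv-nx (suc zero)             = refl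
pv-nx (suc (suc zero))       = refl
pv-nx (suc (suc (suc zero))) = refl

nx³≡pv : ∀ k → nx (nx (nx k)) ≡ pv k
nx³≡pv zero                   = refl
nx³≡pv (suc zero)             = refl
nx³≡pv (suc (suc zero))       = refl
nx³≡pv (suc (suc (suc zero))) = refl

pv²≡nx² : ∀ k → pv (pv k) ≡ nx (nx k)
pv²≡nx² zero                   = refl
pv²≡nx² (suc zero)             = refl
pv²≡nx² (suc (suc zero))       = refl
pv²≡nx² (suc (suc (suc zero))) = refl

module SquareMoveWalks {r n} {G G' : HPG r n} (SM : SquareMove G G') {i : ℕ} (0<i : 0 < i) (i<r : i < r) where
  open SquareMove SM
  private
    module S  = StrandEnds G
    module S' = StrandEnds G'

  Face : Fin (nD G) → Set
  Face = FaceDart G x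

  m : Fin 4 → ℕ
  m k = mult G (x k)

  private
    m₀ m₁ m₂ m₃ : ℕ
    m₀ = m zero
    m₁ = m (suc zero)
    m₂ = m (suc (suc zero))
    m₃ = m (suc (suc (suc zero)))

    rotate : ∀ a b c d → b + c + d + a ≡ a + b + c + d
    rotate = solve-∀

  at-opp-x : ∀ k → at G (opp G (x k)) ≡ inj₁ (v (nx k))
  at-opp-x k = trans (cong (at G) (sym (face k))) (trans (rot-at G (x (nx k))) (x-at (nx k)))

  rot-x : ∀ k → rot G (x k) ≡ opp G (x (pv k))
  rot-x k = trans (cong (rot G ∘ x) (sym (nx-pv k))) (face (pv k))

  face-opp : ∀ y → Face (opp G y) → Face y
  face-opp y (l , inj₁ eq) = l , inj₂ (trans (sym (opp-invol G y)) (cong (opp G) eq))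
  face-opp y (l , inj₂ eq) = l , inj₁ (trans (sym (opp-invol G y)) (trans (cong (opp G) eq) (opp-invol G (x l))))

  face-vertex-is-corner : ∀ {y u} → Face y → at G y ≡ inj₁ u → ∃[ k ] v k ≡ u
  face-vertex-is-corner (l , inj₁ refl) y-at = l    , inj₁-injective (trans (sym (x-at l)) y-at)
  face-vertex-is-corner (l , inj₂ refl) y-at = nx l , inj₁-injective (trans (sym (at-opp-x l)) y-at)

  face-darts-at-corner : ∀ {y} k → Face y → at G y ≡ inj₁ (v k) → y ≡ x k ⊎ y ≡ opp G (x (pv k))
  face-darts-at-corner k (l , inj₁ refl) y-at =
    inj₁ (cong x (v-distinct l k (inj₁-injective (trans (sym (x-at l)) y-at))))
  face-darts-at-corner k (l , inj₂ refl) y-at =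
    inj₂ (cong (opp G ∘ x) (trans (sym (pv-nx l))
           (cong pv (v-distinct (nx l) k (inj₁-injective (trans (sym (at-opp-x l)) y-at))))))

  face-internal : ∀ {y} → Face y → ∃[ u ] at G y ≡ inj₁ u
  face-internal (l , inj₁ refl) = v l , x-at l
  face-internal (l , inj₂ refl) = v (nx l) , at-opp-x l

  bd-not-face : ∀ j → ¬ Face (bd G j)
  bd-not-face j face with trans (sym (bd-at G j)) (proj₂ (face-internal face))
  ... | ()

  corner? : ∀ u → (∃[ k ] v k ≡ u) ⊎ (∀ k → v k ≢ u)
  corner? u with v zero ≟ u | v (suc zero) ≟ u | v (suc (suc zero)) ≟ u | v (suc (suc (suc zero))) ≟ u
  ... | yes eq | _      | _      | _      = inj₁ (_ , eq)
  ... | no _   | yes eq | _      | _      = inj₁ (_ , eq)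
  ... | no _   | no _   | yes eq | _      = inj₁ (_ , eq)
  ... | no _   | no _   | no _   | yes eq = inj₁ (_ , eq)
  ... | no ≢₀  | no ≢₁  | no ≢₂  | no ≢₃  =
    inj₂ λ { zero → ≢₀ ; (suc zero) → ≢₁ ; (suc (suc zero)) → ≢₂ ; (suc (suc (suc zero))) → ≢₃ }

  color-nx : ∀ k → color G (v (nx k)) ≡ flipColor (color G (v k))
  color-nx k = ≢⇒flipColor (bipartite G (x k) (v k) (v (nx k)) (x-at k) (at-opp-x k))

  color-pv : ∀ k → color G (v (pv k)) ≡ flipColor (color G (v k))
  color-pv k = trans (sym (flipColor-involutive _))
    (cong flipColor (sym (trans (cong (color G ∘ v) (sym (nx-pv k))) (color-nx (pv k)))))

  mult-around : ∀ k → m k + m (nx k) + m (nx (nx k)) + m (pv k) ≡ r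
  mult-around zero                   = mult-sum
  mult-around (suc zero)             = trans (rotate m₀ m₁ m₂ m₃) mult-sum
  mult-around (suc (suc zero))       = trans (rotate m₁ m₂ m₃ m₀) (trans (rotate m₀ m₁ m₂ m₃) mult-sum)
  mult-around (suc (suc (suc zero))) =
    trans (rotate m₂ m₃ m₀ m₁) (trans (rotate m₁ m₂ m₃ m₀) (trans (rotate m₀ m₁ m₂ m₃) mult-sum))

  embedding : DartEmbedding G G'
  embedding = record
    { Changed      = Face
    ; vmap         = oldV
    ; dmap         = oldD
    ; changed-opp  = face-opp
    ; bd-unchanged = bd-not-face
    ; at-dmap      = at-old
    ; opp-dmap     = opp-old
    ; mult-dmap    = mult-old
    ; rot-dmap     = rot-old
    }

  open Embedding embedding i
  open Walks G i using ([_]; next; via)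
  open Walks G' i using () renaming ([_] to [_]'; next to next'; via to via')

  module V  (k : Fin 4) = S.Around  (v k)        (x k)         (x-at k)
  module V' (k : Fin 4) = S'.Around (oldV (v k)) (newD (vw k)) (at-vw k)
  module W  (k : Fin 4) = S'.Around (newV k)     (newD (wv k)) (at-wv k)

  mult-wv : ∀ k → mult G' (newD (wv k)) ≡ m (pv k) + m k
  mult-wv k = trans (cong (mult G') (sym (opp-new (vw k)))) (trans (mult-opp G' _) (mult-vw k))

  mult-ww' : ∀ k → mult G' (newD (ww' k)) ≡ m (nx (nx k))
  mult-ww' k = trans (cong (mult G') (sym (opp-new (ww k)))) (trans (mult-opp G' _) (mult-ww k))

  V-x : ∀ k p (p<m : p < m k) → V.pos k p ≡ (x k , p , p<m)
  V-x k = V.pos-offset k 0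

  V-opp-x : ∀ k p (p<m : p < mult G (opp G (x (pv k)))) → V.pos k (m k + p) ≡ (opp G (x (pv k)) , p , p<m)
  V-opp-x k p p<m =
    trans (V.pos-offset k 1 p (subst (λ y → p < mult G y) (sym (rot-x k)) p<m)) (S.strandEnd-≡ (rot-x k) refl)

  V'-vw : ∀ k p (p<m : p < mult G' (newD (vw k))) → V'.pos k p ≡ (newD (vw k) , p , p<m)
  V'-vw k = V'.pos-offset k 0

  W-wv : ∀ k p (p<m : p < mult G' (newD (wv k))) → W.pos k p ≡ (newD (wv k) , p , p<m)
  W-wv k = W.pos-offset k 0

  W-ww : ∀ k p (p<m : p < mult G' (newD (ww k))) → W.pos k (m (pv k) + m k + p) ≡ (newD (ww k) , p , p<m)
  W-ww k p p<m = trans (cong (λ o → W.pos k (o + p)) (sym (mult-wv k)))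
    (trans (W.pos-offset k 1 p (subst (λ y → p < mult G' y) (sym (rot-wv k)) p<m))
           (S'.strandEnd-≡ (rot-wv k) refl))

  W-ww' : ∀ k p (p<m : p < mult G' (newD (ww' (pv k)))) →
          W.pos k (m (pv k) + m k + m (nx (nx k)) + p) ≡ (newD (ww' (pv k)) , p , p<m)
  W-ww' k p p<m = trans (cong (λ o → W.pos k (o + p)) (sym offset₂))
    (trans (W.pos-offset k 2 p (subst (λ y → p < mult G' y) (sym rot²-wv) p<m))
           (S'.strandEnd-≡ rot²-wv refl))
    where
    rot²-wv : rot G' (rot G' (newD (wv k))) ≡ newD (ww' (pv k))
    rot²-wv = trans (cong (rot G') (rot-wv k)) (rot-ww k)
    offset₂ : W.offset k 2 ≡ m (pv k) + m k + m (nx (nx k))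
    offset₂ = cong₂ _+_ (mult-wv k) (trans (cong (mult G') (rot-wv k)) (mult-ww k))

  outside-unchanged : ∀ k T → m k + m (pv k) ≤ T → T < r → ¬ Face (proj₁ (V.pos k T))
  outside-unchanged k T inner≤T T<r face with face-darts-at-corner k face (V.at-pos k T)
  ... | inj₁ is-x = <-irrefl (sym T≡p) p<T
    where
    p = proj₁ (proj₂ (V.pos k T))
    p<m : p < m k
    p<m = subst (λ y → p < mult G y) is-x (proj₂ (proj₂ (V.pos k T)))
    p<T : p < T
    p<T = <-≤-trans p<m (≤-trans (m≤m+n (m k) (m (pv k))) inner≤T)
    T≡p : T ≡ p
    T≡p = V.pos-injective k T<r (<-trans p<T T<r) (trans (S.strandEnd-≡ is-x refl) (sym (V-x k p p<m)))
  ... | inj₂ is-opp-x = <-irrefl (sym T≡mk+p) mk+p<T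
    where
    p = proj₁ (proj₂ (V.pos k T))
    p<m : p < mult G (opp G (x (pv k)))
    p<m = subst (λ y → p < mult G y) is-opp-x (proj₂ (proj₂ (V.pos k T)))
    mk+p<T : m k + p < T
    mk+p<T = <-≤-trans (+-monoʳ-< (m k) (subst (p <_) (mult-opp G (x (pv k))) p<m)) inner≤T
    T≡mk+p : T ≡ m k + p
    T≡mk+p = V.pos-injective k T<r (<-trans mk+p<T T<r)
               (trans (S.strandEnd-≡ is-opp-x refl) (sym (V-opp-x k p p<m)))

  outside-∼ : ∀ k T → m k + m (pv k) ≤ T → T < r → V.pos k T ∼ V'.pos k T
  outside-∼ k T inner≤T T<r with m≤n⇒∃[o]m+o≡n inner≤T
  ... | u , refl = go u T<r
    where
    inner = m k + m (pv k)
    go : ∀ u → inner + u < r → V.pos k (inner + u) ∼ V'.pos k (inner + u)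
    go zero inner<r = ∼-subst (sym G-side) (sym G'-side) (corr kept (rot-vw-old k kept) refl)
      where
      G-side : V.pos k (inner + 0) ≡ S.first (rot G (opp G (x (pv k))))
      G-side = trans (cong (λ o → V.pos k (m k + o + 0)) (sym (trans (cong (mult G) (rot-x k)) (mult-opp G _))))
                 (trans (V.pos-offset k 2 0 (mult-pos G _)) (S.strandEnd-≡ (cong (rot G) (rot-x k)) refl))
      G'-side : V'.pos k (inner + 0) ≡ S'.first (rot G' (newD (vw k)))
      G'-side = trans (cong (λ o → V'.pos k (o + 0)) (sym (trans (mult-vw k) (+-comm (m (pv k)) (m k)))))
                  (V'.pos-offset k 1 0 (mult-pos G' _))
      kept : ¬ Face (rot G (opp G (x (pv k))))
      kept = subst (¬_ ∘ Face ∘ proj₁) G-side (outside-unchanged k (inner + 0) (m≤m+n inner 0) inner<r)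
    go (suc u) inner+1+u<r = ∼-subst (cong (V.pos k) (sym (+-suc inner u))) (cong (V'.pos k) (sym (+-suc inner u)))
      (cw-∼ (go u (<-trans (n<1+n _) 1+inner+u<r))
            (outside-unchanged k (suc (inner + u)) (≤-trans (m≤m+n inner u) (n≤1+n _)) 1+inner+u<r))
      where
      1+inner+u<r : suc (inner + u) < r
      1+inner+u<r = subst (_< r) (+-suc inner u) inner+1+u<r

  -- Neighbouring corners are arguments tied to k by equations, so that callers may name them
  -- through the identities of nx and pv instead of rewriting.
  cross-x : ∀ {k k'} → nx k ≡ k' → ∀ {p} → p < m k → cross G (V.pos k p) ≡ V.pos k' (m k' + p)
  cross-x {k} refl {p} p<m = begin
      cross G (V.pos k p)
    ≡⟨ cong (cross G) (V-x k p p<m) ⟩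
      (opp G (x k) , p , _)
    ≡⟨ S.strandEnd-≡ (cong (opp G ∘ x) (sym (pv-nx k))) refl ⟩
      (opp G (x (pv (nx k))) , p , p<m')
    ≡⟨ sym (V-opp-x (nx k) p p<m') ⟩
      V.pos (nx k) (m (nx k) + p) ∎
    where
    open ≡-Reasoning
    p<m' : p < mult G (opp G (x (pv (nx k))))
    p<m' = subst (p <_) (sym (trans (mult-opp G _) (cong m (pv-nx k)))) p<m

  cross-opp-x : ∀ {k k'} → pv k ≡ k' → ∀ {p} → p < m k' → cross G (V.pos k (m k + p)) ≡ V.pos k' p
  cross-opp-x {k} refl {p} p<m = begin
      cross G (V.pos k (m k + p))
    ≡⟨ cong (cross G) (V-opp-x k p (subst (p <_) (sym (mult-opp G _)) p<m)) ⟩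
      (opp G (opp G (x (pv k))) , p , _)
    ≡⟨ S.strandEnd-≡ (opp-invol G (x (pv k))) refl ⟩
      (x (pv k) , p , p<m)
    ≡⟨ sym (V-x (pv k) p p<m) ⟩
      V.pos (pv k) p ∎
    where open ≡-Reasoning

  cross-vw : ∀ k {p} → p < m (pv k) + m k → cross G' (V'.pos k p) ≡ W.pos k p
  cross-vw k {p} p<m = begin
      cross G' (V'.pos k p)
    ≡⟨ cong (cross G') (V'-vw k p (subst (p <_) (sym (mult-vw k)) p<m)) ⟩
      (opp G' (newD (vw k)) , p , _)
    ≡⟨ S'.strandEnd-≡ (opp-new (vw k)) refl ⟩
      (newD (wv k) , p , subst (p <_) (sym (mult-wv k)) p<m)
    ≡⟨ sym (W-wv k p _) ⟩
      W.pos k p ∎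
    where open ≡-Reasoning

  cross-wv : ∀ {k k'} → pv k ≡ k' → ∀ {p} → p < m k' + m k → cross G' (W.pos k p) ≡ V'.pos k p
  cross-wv {k} refl {p} p<m = begin
      cross G' (W.pos k p)
    ≡⟨ cong (cross G') (W-wv k p (subst (p <_) (sym (mult-wv k)) p<m)) ⟩
      (opp G' (newD (wv k)) , p , _)
    ≡⟨ S'.strandEnd-≡ (opp-new (wv k)) refl ⟩
      (newD (vw k) , p , subst (p <_) (sym (mult-vw k)) p<m)
    ≡⟨ sym (V'-vw k p _) ⟩
      V'.pos k p ∎
    where open ≡-Reasoning

  cross-ww : ∀ {k k₁ k₂ k₃} → nx k ≡ k₁ → nx k₁ ≡ k₂ → pv k ≡ k₃ → ∀ {p} → p < m k₂ →
             cross G' (W.pos k (m k₃ + m k + p)) ≡ W.pos k₁ (m k + m k₁ + m k₃ + p)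
  cross-ww {k} refl refl refl {p} p<m = begin
      cross G' (W.pos k (m (pv k) + m k + p))
    ≡⟨ cong (cross G') (W-ww k p (subst (p <_) (sym (mult-ww k)) p<m)) ⟩
      (opp G' (newD (ww k)) , p , _)
    ≡⟨ S'.strandEnd-≡ (trans (opp-new (ww k)) (cong (newD ∘ ww') (sym (pv-nx k)))) refl ⟩
      (newD (ww' (pv (nx k))) , p , p<m')
    ≡⟨ sym (W-ww' (nx k) p p<m') ⟩
      W.pos (nx k) (m (pv (nx k)) + m (nx k) + m (nx (nx (nx k))) + p)
    ≡⟨ cong₂ (λ a b → W.pos (nx k) (m a + m (nx k) + m b + p)) (pv-nx k) (nx³≡pv k) ⟩
      W.pos (nx k) (m k + m (nx k) + m (pv k) + p) ∎
    where
    open ≡-Reasoning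
    p<m' : p < mult G' (newD (ww' (pv (nx k))))
    p<m' = subst (p <_) (sym (trans (mult-ww' (pv (nx k))) (cong (m ∘ nx ∘ nx) (pv-nx k)))) p<m

  cross-ww' : ∀ {k k₁ k₂ k₃} → nx k ≡ k₁ → nx k₁ ≡ k₂ → pv k ≡ k₃ → ∀ {p} → p < m k₁ →
              cross G' (W.pos k (m k₃ + m k + m k₂ + p)) ≡ W.pos k₃ (m k₂ + m k₃ + p)
  cross-ww' {k} refl refl refl {p} p<m = begin
      cross G' (W.pos k (m (pv k) + m k + m (nx (nx k)) + p))
    ≡⟨ cong (cross G') (W-ww' k p (subst (p <_) (sym (trans (mult-ww' (pv k)) m-nx²-pv)) p<m)) ⟩
      (opp G' (newD (ww' (pv k))) , p , _)
    ≡⟨ S'.strandEnd-≡ (opp-new (ww' (pv k))) refl ⟩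
      (newD (ww (pv k)) , p , p<m')
    ≡⟨ sym (W-ww (pv k) p p<m') ⟩
      W.pos (pv k) (m (pv (pv k)) + m (pv k) + p)
    ≡⟨ cong (λ a → W.pos (pv k) (m a + m (pv k) + p)) (pv²≡nx² k) ⟩
      W.pos (pv k) (m (nx (nx k)) + m (pv k) + p) ∎
    where
    open ≡-Reasoning
    m-nx²-pv : m (nx (nx (pv k))) ≡ m (nx k)
    m-nx²-pv = cong (m ∘ nx) (nx-pv k)
    p<m' : p < mult G' (newD (ww (pv k)))
    p<m' = subst (p <_) (sym (trans (mult-ww (pv k)) m-nx²-pv)) p<m

  shiftV shiftW : Fin 4 → ℕ
  shiftV k = advance r i (color G (v k))
  shiftW k = advance r i (flipColor (color G (v k)))

  private
    i≤r : i ≤ r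
    i≤r = <⇒≤ i<r

  next-V : ∀ k X → next (v k) (V.pos k X) ≡ cross G (V.pos k (X + shiftV k))
  next-V k X = cong (cross G) (V.turn-pos k i≤r (color G (v k)) X)

  next-V' : ∀ k X → next' (oldV (v k)) (V'.pos k X) ≡ cross G' (V'.pos k (X + shiftV k))
  next-V' k X = cong (cross G') (trans (cong (λ c → turn G' c i (V'.pos k X)) (color-old (v k)))
                                       (V'.turn-pos k i≤r (color G (v k)) X))

  next-W : ∀ k X → next' (newV k) (W.pos k X) ≡ cross G' (W.pos k (X + shiftW k))
  next-W k X = cong (cross G') (trans (cong (λ c → turn G' c i (W.pos k X)) (color-new k))
                                      (W.turn-pos k i≤r (flipColor (color G (v k))) X))

  hop-x : ∀ {k k' s} → nx k ≡ k' → shiftV k ≡ s → ∀ X {p} → Wrap r (X + s) p → p < m k →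
          next (v k) (V.pos k X) ≡ V.pos k' (m k' + p)
  hop-x {k} k' refl X w p<m = trans (next-V k X) (trans (cong (cross G) (V.pos-wrap k w)) (cross-x k' p<m))

  hop-opp-x : ∀ {k k' s} → pv k ≡ k' → shiftV k ≡ s → ∀ X {p} → Wrap r (X + s) (m k + p) → p < m k' →
              next (v k) (V.pos k X) ≡ V.pos k' p
  hop-opp-x {k} k' refl X w p<m =
    trans (next-V k X) (trans (cong (cross G) (V.pos-wrap k w)) (cross-opp-x k' p<m))

  hop-vw : ∀ k {s} → shiftV k ≡ s → ∀ X {p} → Wrap r (X + s) p → p < m (pv k) + m k →
           next' (oldV (v k)) (V'.pos k X) ≡ W.pos k p
  hop-vw k refl X w p<m = trans (next-V' k X) (trans (cong (cross G') (V'.pos-wrap k w)) (cross-vw k p<m))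

  hop-wv : ∀ {k k' s} → pv k ≡ k' → shiftW k ≡ s → ∀ X {p} → Wrap r (X + s) p → p < m k' + m k →
           next' (newV k) (W.pos k X) ≡ V'.pos k p
  hop-wv {k} k' refl X w p<m = trans (next-W k X) (trans (cong (cross G') (W.pos-wrap k w)) (cross-wv k' p<m))

  hop-ww : ∀ {k k₁ k₂ k₃ s} → nx k ≡ k₁ → nx k₁ ≡ k₂ → pv k ≡ k₃ → shiftW k ≡ s → ∀ X {p} →
           Wrap r (X + s) (m k₃ + m k + p) → p < m k₂ →
           next' (newV k) (W.pos k X) ≡ W.pos k₁ (m k + m k₁ + m k₃ + p)
  hop-ww {k} k₁ k₂ k₃ refl X w p<m =
    trans (next-W k X) (trans (cong (cross G') (W.pos-wrap k w)) (cross-ww k₁ k₂ k₃ p<m))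

  hop-ww' : ∀ {k k₁ k₂ k₃ s} → nx k ≡ k₁ → nx k₁ ≡ k₂ → pv k ≡ k₃ → shiftW k ≡ s → ∀ X {p} →
            Wrap r (X + s) (m k₃ + m k + m k₂ + p) → p < m k₁ →
            next' (newV k) (W.pos k X) ≡ W.pos k₃ (m k₂ + m k₃ + p)
  hop-ww' {k} k₁ k₂ k₃ refl X w p<m =
    trans (next-W k X) (trans (cong (cross G') (W.pos-wrap k w)) (cross-ww' k₁ k₂ k₃ p<m))

  exit : ∀ {k k' s} → pv k ≡ k' → shiftV k ≡ s → ∀ X {Y} →
         Wrap r (X + s) Y → m k + m k' ≤ Y → Y < r →
         next (v k) (V.pos k X) ∼ next' (oldV (v k)) (V'.pos k X)
  exit {k} refl refl X w inner≤Y Y<r =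
    ∼-subst (sym (trans (next-V k X) (cong (cross G) (V.pos-wrap k w))))
            (sym (trans (next-V' k X) (cong (cross G') (V'.pos-wrap k w))))
            (cross-∼ (outside-∼ k _ inner≤Y Y<r))

  module Corner (j : Fin 4) where
    j₁ j₂ j₃ : Fin 4
    j₁ = nx j
    j₂ = nx (nx j)
    j₃ = pv j

    a b c d α β : ℕ
    a = m j
    b = m j₁
    c = m j₂
    d = m j₃
    α = shiftV j
    β = shiftW j

    a+b+c+d≡r : a + b + c + d ≡ r
    a+b+c+d≡r = mult-around j

    α+β≡r : α + β ≡ r
    α+β≡r = advance-flip i≤r (color G (v j))

    color-j₂ : color G (v j₂) ≡ color G (v j)
    color-j₂ = trans (color-nx j₁) (trans (cong flipColor (color-nx j)) (flipColor-involutive _))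

    shift-v₁ : shiftV j₁ ≡ β
    shift-v₁ = cong (advance r i) (color-nx j)

    shift-v₂ : shiftV j₂ ≡ α
    shift-v₂ = cong (advance r i) color-j₂

    shift-v₃ : shiftV j₃ ≡ β
    shift-v₃ = cong (advance r i) (color-pv j)

    shift-w₁ : shiftW j₁ ≡ α
    shift-w₁ = cong (advance r i) (trans (cong flipColor (color-nx j)) (flipColor-involutive _))

    shift-w₂ : shiftW j₂ ≡ β
    shift-w₂ = cong (advance r i ∘ flipColor) color-j₂

    shift-w₃ : shiftW j₃ ≡ α
    shift-w₃ = cong (advance r i) (trans (cong flipColor (color-pv j)) (flipColor-involutive _))

    open CornerArithmetic a b c d r α β a+b+c+d≡r α+β≡r

    rejoin-direct : ∀ e {Y} → Wrap r (e + α) Y → a + d ≤ Y → Y < r →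
                    Rejoins (V.pos j e) (V'.pos j e)
    rejoin-direct e lands a+d≤Y Y<r =
      _ , _ , [ V.at-pos j e ] , [ V'.at-pos j e ]' , exit refl refl e lands a+d≤Y Y<r

    rejoin-via-next : ∀ {o d'} → b + c + d' ≡ o + α → d' < a → o < c →
                      Rejoins (V.pos j (a + d + o)) (V'.pos j (a + d + o))
    rejoin-via-next {o} {d'} E d'<a o<c =
      _ , _ ,
      via (V.at-pos j e) (hop-x refl refl e (inj₂ lands) d'<a) [ V.at-pos j₁ (b + d') ] ,
      via' (V'.at-pos j e) (hop-vw j refl e (inj₂ lands) (<-≤-trans d'<a (m≤n+m a d)))
        (via' (W.at-pos j d') (hop-ww refl refl refl refl d' (inj₁ turn-at-w) o<c)
          (via' (W.at-pos j₁ (a + b + d + o))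
                (hop-wv (pv-nx j) shift-w₁ (a + b + d + o) (inj₂ turn-at-w₁)
                        (subst (b + d' <_) (+-comm b a) (+-monoʳ-< b d'<a)))
            [ V'.at-pos j₁ (b + d') ]')) ,
      exit (pv-nx j) shift-v₁ (b + d') (inj₁ turn-at-v₁)
           (+-monoʳ-≤ b (≤-trans (m≤n+m a d) (m≤m+n (d + a) o))) (exit<r o<c)
      where
      open ViaNext E
      e = a + d + o

    rejoin-via-next-two : ∀ {o' d'} → b + c + d' ≡ c + o' + α → d' < a → o' < b →
                          Rejoins (V.pos j (a + d + (c + o'))) (V'.pos j (a + d + (c + o')))
    rejoin-via-next-two {o'} {d'} E d'<a o'<b =
      _ , _ ,
      via (V.at-pos j e) (hop-x refl refl e (inj₂ lands) d'<a)
        (via (V.at-pos j₁ (b + d')) (hop-x refl shift-v₁ (b + d') (inj₂ turn-at-v₁) o'<b)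
          [ V.at-pos j₂ (c + o') ]) ,
      via' (V'.at-pos j e) (hop-vw j refl e (inj₂ lands) (<-≤-trans d'<a (m≤n+m a d)))
        (via' (W.at-pos j d') (hop-ww' refl refl refl refl d' (inj₁ turn-at-w) o'<b)
          (via' (W.at-pos j₃ (c + d + o'))
                (hop-ww' (nx-pv j) refl (pv²≡nx² j) shift-w₃ (c + d + o') (inj₁ turn-at-w₃) d'<a)
            (via' (W.at-pos j₂ (b + c + d'))
                  (hop-wv (pv-nx j₁) shift-w₂ (b + c + d') (inj₂ turn-at-w₂)
                          (subst (c + o' <_) (+-comm c b) (+-monoʳ-< c o'<b)))
              [ V'.at-pos j₂ (c + o') ]'))) ,
      exit (pv-nx j₁) shift-v₂ (c + o') (inj₁ turn-at-v₂) (m≤m+n (c + b) d') (exit<r d'<a)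
      where
      open ViaNextTwo E
      e = a + d + (c + o')

    rejoin-via-prev-two : ∀ {o q} → b + c + (a + q) ≡ o + α → q < d → o < c → o < b + c →
                          Rejoins (V.pos j (a + d + o)) (V'.pos j (a + d + o))
    rejoin-via-prev-two {o} {q} E q<d o<c o<b+c =
      _ , _ ,
      via (V.at-pos j e) (hop-opp-x refl refl e (inj₂ lands) q<d)
        (via (V.at-pos j₃ q) (hop-opp-x (pv²≡nx² j) shift-v₃ q (inj₁ turn-at-v₃) o<c)
          [ V.at-pos j₂ o ]) ,
      via' (V'.at-pos j e) (hop-vw j refl e (inj₂ lands) a+q<d+a)
        (via' (W.at-pos j (a + q)) (hop-ww refl refl refl refl (a + q) (inj₁ turn-at-w) o<c)
          (via' (W.at-pos j₁ (a + b + d + o))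
                (hop-ww refl (nx³≡pv j) (pv-nx j) shift-w₁ (a + b + d + o) (inj₂ turn-at-w₁) q<d)
            (via' (W.at-pos j₂ (b + c + a + q))
                  (hop-wv (pv-nx j₁) shift-w₂ (b + c + a + q) (inj₂ turn-at-w₂) o<b+c)
              [ V'.at-pos j₂ o ]'))) ,
      exit (pv-nx j₁) shift-v₂ o (inj₁ turn-at-v₂) (m≤m+n (c + b) (a + q)) (exit<r q<d)
      where
      open ViaPrevTwo E
      e = a + d + o
      a+q<d+a : a + q < d + a
      a+q<d+a = subst (a + q <_) (+-comm a d) (+-monoʳ-< a q<d)

    rejoin-via-prev : ∀ {o'' q} → b + c + (a + q) ≡ c + o'' + α → q < d → o'' < b →
                      Rejoins (V.pos j (a + d + (c + o''))) (V'.pos j (a + d + (c + o'')))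
    rejoin-via-prev {o''} {q} E q<d o''<b =
      _ , _ ,
      via (V.at-pos j e) (hop-opp-x refl refl e (inj₂ lands) q<d) [ V.at-pos j₃ q ] ,
      via' (V'.at-pos j e) (hop-vw j refl e (inj₂ lands) a+q<d+a)
        (via' (W.at-pos j (a + q)) (hop-ww' refl refl refl refl (a + q) (inj₁ turn-at-w) o''<b)
          (via' (W.at-pos j₃ (c + d + o''))
                (hop-wv (pv²≡nx² j) shift-w₃ (c + d + o'') (inj₂ turn-at-w₃) (<-≤-trans q<d (m≤n+m d c)))
            [ V'.at-pos j₃ q ]')) ,
      exit (pv²≡nx² j) shift-v₃ q (inj₁ turn-at-v₃) (m≤m+n (d + c) o'') (exit<r o''<b)
      where
      open ViaPrev E
      e = a + d + (c + o'')
      a+q<d+a : a + q < d + a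
      a+q<d+a = subst (a + q <_) (+-comm a d) (+-monoʳ-< a q<d)

    rejoin-outside : ∀ e → a + d ≤ e → e < r → Rejoins (V.pos j e) (V'.pos j e)
    rejoin-outside e a+d≤e e<r with m≤n⇒∃[o]m+o≡n a+d≤e
    ... | o , refl with <⊎≥+ (o + α) (b + c)
    ...   | inj₁ o+α<b+c =
            rejoin-direct e (inj₁ refl) (≤-trans (m≤m+n (a + d) o) (m≤m+n _ α)) (direct-exit<r o+α<b+c)
    ...   | inj₂ (d' , E) with <⊎≥+ d' a | <⊎≥+ o c
    ...     | inj₁ d'<a | inj₁ o<c = rejoin-via-next E d'<a o<c
    ...     | inj₁ d'<a | inj₂ (o' , refl) =
              rejoin-via-next-two E d'<a (+-cancelˡ-< c o' b (subst (c + o' <_) (+-comm b c) (entering-range e<r)))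
    ...     | inj₂ (q , refl) | o<c? with <⊎≥+ q d
    ...       | inj₂ (o₂ , refl) =
                rejoin-direct e (inj₂ (Wrapped.lands E)) (m≤m+n (a + d) o₂)
                  (Wrapped.exit<r E (entering-range e<r) (advance-< 0<i i<r (color G (v j))))
    ...       | inj₁ q<d with o<c?
    ...         | inj₁ o<c = rejoin-via-prev-two E q<d o<c (entering-range e<r)
    ...         | inj₂ (o'' , refl) =
                  rejoin-via-prev E q<d (+-cancelˡ-< c o'' b (subst (c + o'' <_) (+-comm b c) (entering-range e<r)))

  inside-face : ∀ k e → e < m k + m (pv k) → Face (proj₁ (V.pos k e))
  inside-face k e e<inner with <⊎≥+ e (m k)
  ... | inj₁ e<m = subst (Face ∘ proj₁) (sym (V-x k e e<m)) (k , inj₁ refl)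
  ... | inj₂ (p , refl) = subst (Face ∘ proj₁) (sym (V-opp-x k p p<m)) (pv k , inj₂ refl)
    where
    p<m : p < mult G (opp G (x (pv k)))
    p<m = subst (p <_) (sym (mult-opp G _)) (+-cancelˡ-< (m k) p (m (pv k)) e<inner)

  rejoin-corner : ∀ j {s s'} → s ∼ s' → at G (proj₁ s) ≡ inj₁ (v j) → Rejoins s s'
  rejoin-corner j {s} s∼s' s-at with V.pos-surjective j s s-at
  ... | e , e<r , refl with <⊎≥+ e (m j + m (pv j))
  ...   | inj₁ e<inner = ⊥-elim (unchanged s∼s' (inside-face j e e<inner))
  ...   | inj₂ (o , refl) =
          subst (Rejoins (V.pos j e)) (∼-functional (outside-∼ j e inner≤e e<r) s∼s')
                (Corner.rejoin-outside j e inner≤e e<r)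
    where
    inner≤e : m j + m (pv j) ≤ e
    inner≤e = m≤m+n _ o

  rejoin : ∀ {s s' u} → s ∼ s' → at G (proj₁ s) ≡ inj₁ u → Rejoins s s'
  rejoin {u = u} s∼s' s-at with corner? u
  ... | inj₁ (j , refl) = rejoin-corner j s∼s' s-at
  ... | inj₂ not-corner = rejoin-untouched untouched (color-old u) s∼s' s-at
    where
    untouched : Untouched u
    untouched y y-at face = let (k , vk≡u) = face-vertex-is-corner face y-at in not-corner k vk≡u

  square-trip⇔ : ∀ j k → Trip G i j k ⇔ Trip G' i j k
  square-trip⇔ = trip⇔ rejoin

-- At p₁ (resp. p₂) the positions [0, a) (resp. [0, a₂)) lie on the edge to u, where a and a₂
-- are the multiplicities at u; the merged vertex of G' lists the remaining positions of p₁,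
-- then those of p₂.  Turns at p₁, p₂ and the merged vertex advance by α, turns at u by β.
module ContractionArithmetic (a a₂ r α β : ℕ) (aa₂≡r : a + a₂ ≡ r) (αβ≡r : α + β ≡ r) where

  direct-exit<r : ∀ {o} → o + α < a → a₂ + o + α < r
  direct-exit<r {o} lt = linear-< aa₂≡r lt (solve (a ∷ a₂ ∷ r ∷ α ∷ o ∷ []))

  module FromP₁ {o d} (E : a₂ + d ≡ o + α) where
    lands : a + o + α ≡ d + r
    lands = linear (cong₂ _+_ (sym E) aa₂≡r) (solve (a ∷ a₂ ∷ r ∷ α ∷ o ∷ d ∷ []))

    turn-at-u : d + β ≡ a + o
    turn-at-u = linear (cong₂ _+_ E (cong₂ _+_ αβ≡r (sym aa₂≡r)))
                  (solve (a ∷ a₂ ∷ r ∷ α ∷ β ∷ o ∷ d ∷ []))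

    exit<r : d < a → a₂ + d < r
    exit<r d<a = linear-< aa₂≡r d<a (solve (a ∷ a₂ ∷ r ∷ d ∷ []))

  module FromP₁Wrapped {o o₂} (E : a₂ + (a + o₂) ≡ o + α) where
    lands : a + o + α ≡ a + o₂ + r
    lands = linear (cong₂ _+_ (sym E) aa₂≡r) (solve (a ∷ a₂ ∷ r ∷ α ∷ o ∷ o₂ ∷ []))

    lands' : o + α ≡ o₂ + r
    lands' = linear (cong₂ _+_ (sym E) aa₂≡r) (solve (a ∷ a₂ ∷ r ∷ α ∷ o ∷ o₂ ∷ []))

    o₂<a₂ : o < a₂ → α < r → o₂ < a₂
    o₂<a₂ o<a₂ α<r = linear-< (sym lands') (+-mono-< o<a₂ α<r) (solve (a₂ ∷ r ∷ α ∷ o ∷ o₂ ∷ []))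

  module FromP₂ {o d} (E : a + d ≡ o + α) where
    lands : a₂ + o + α ≡ d + r
    lands = linear (cong₂ _+_ (sym E) aa₂≡r) (solve (a ∷ a₂ ∷ r ∷ α ∷ o ∷ d ∷ []))

    turn-at-u : a + d + β ≡ o + r
    turn-at-u = linear (cong₂ _+_ E αβ≡r) (solve (a ∷ r ∷ α ∷ β ∷ o ∷ d ∷ []))

  module FromP₂Wrapped {o o₂} (E : a + (a₂ + o₂) ≡ o + α) where
    lands : a₂ + o + α ≡ a₂ + o₂ + r
    lands = linear (cong₂ _+_ (sym E) aa₂≡r) (solve (a ∷ a₂ ∷ r ∷ α ∷ o ∷ o₂ ∷ []))

    exit<r : o < a → α < r → a₂ + o₂ < r
    exit<r o<a α<r = linear-< E (+-mono-< o<a α<r) (solve (a ∷ a₂ ∷ r ∷ α ∷ o ∷ o₂ ∷ []))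

module ContractionWalks {r n} {G G' : HPG r n} (CT : Contraction G G') {i : ℕ} (0<i : 0 < i) (i<r : i < r) where
  open Contraction CT
  private
    module S  = StrandEnds G
    module S' = StrandEnds G'

  Rem : Fin (nD G) → Set
  Rem = Removed G y₁ y₂

  u≢p₁ : u ≢ p₁
  u≢p₁ eq = bipartite G y₁ u p₁ y₁-at p₁-at (cong (color G) eq)

  u≢p₂ : u ≢ p₂
  u≢p₂ eq = bipartite G y₂ u p₂ y₂-at p₂-at (cong (color G) eq)

  removed-at : ∀ {z q} → Rem z → at G z ≡ inj₁ q → q ≡ u ⊎ q ≡ p₁ ⊎ q ≡ p₂
  removed-at (inj₁ refl)               z-at = inj₁ (inj₁-injective (trans (sym z-at) y₁-at))
  removed-at (inj₂ (inj₁ refl))        z-at = inj₁ (inj₁-injective (trans (sym z-at) y₂-at))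
  removed-at (inj₂ (inj₂ (inj₁ refl))) z-at = inj₂ (inj₁ (inj₁-injective (trans (sym z-at) p₁-at)))
  removed-at (inj₂ (inj₂ (inj₂ refl))) z-at = inj₂ (inj₂ (inj₁-injective (trans (sym z-at) p₂-at)))

  removed-at-p₁ : ∀ {z} → Rem z → at G z ≡ inj₁ p₁ → z ≡ opp G y₁
  removed-at-p₁ (inj₁ refl)               z-at = ⊥-elim (u≢p₁ (inj₁-injective (trans (sym y₁-at) z-at)))
  removed-at-p₁ (inj₂ (inj₁ refl))        z-at = ⊥-elim (u≢p₁ (inj₁-injective (trans (sym y₂-at) z-at)))
  removed-at-p₁ (inj₂ (inj₂ (inj₁ eq)))   _    = eq
  removed-at-p₁ (inj₂ (inj₂ (inj₂ refl))) z-at = ⊥-elim (p₁≢p₂ (inj₁-injective (trans (sym z-at) p₂-at)))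

  removed-at-p₂ : ∀ {z} → Rem z → at G z ≡ inj₁ p₂ → z ≡ opp G y₂
  removed-at-p₂ (inj₁ refl)               z-at = ⊥-elim (u≢p₂ (inj₁-injective (trans (sym y₁-at) z-at)))
  removed-at-p₂ (inj₂ (inj₁ refl))        z-at = ⊥-elim (u≢p₂ (inj₁-injective (trans (sym y₂-at) z-at)))
  removed-at-p₂ (inj₂ (inj₂ (inj₁ refl))) z-at = ⊥-elim (p₁≢p₂ (inj₁-injective (trans (sym p₁-at) z-at)))
  removed-at-p₂ (inj₂ (inj₂ (inj₂ eq)))   _    = eq

  removed-opp : ∀ z → Rem (opp G z) → Rem z
  removed-opp z (inj₁ eq) =
    inj₂ (inj₂ (inj₁ (trans (sym (opp-invol G z)) (cong (opp G) eq))))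
  removed-opp z (inj₂ (inj₁ eq)) =
    inj₂ (inj₂ (inj₂ (trans (sym (opp-invol G z)) (cong (opp G) eq))))
  removed-opp z (inj₂ (inj₂ (inj₁ eq))) =
    inj₁ (trans (sym (opp-invol G z)) (trans (cong (opp G) eq) (opp-invol G y₁)))
  removed-opp z (inj₂ (inj₂ (inj₂ eq))) =
    inj₂ (inj₁ (trans (sym (opp-invol G z)) (trans (cong (opp G) eq) (opp-invol G y₂))))

  removed-internal : ∀ {z} → Rem z → ∃[ q ] at G z ≡ inj₁ q
  removed-internal (inj₁ refl)               = u  , y₁-at
  removed-internal (inj₂ (inj₁ refl))        = u  , y₂-at
  removed-internal (inj₂ (inj₂ (inj₁ refl))) = p₁ , p₁-at
  removed-internal (inj₂ (inj₂ (inj₂ refl))) = p₂ , p₂-at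

  bd-not-removed : ∀ j → ¬ Rem (bd G j)
  bd-not-removed j rem with trans (sym (bd-at G j)) (proj₂ (removed-internal rem))
  ... | ()

  rot-y₁ : rot G y₁ ≡ y₂
  rot-y₁ with simple-deg-2 (rot G y₁) (trans (rot-at G y₁) y₁-at)
  ... | inj₂ eq = eq
  ... | inj₁ fixed with rot-cycle G y₁ y₂ (trans y₁-at (sym y₂-at))
  ...   | k , reaches-y₂ = ⊥-elim (y₁≢y₂ (trans (sym (stays k)) reaches-y₂))
    where
    stays : ∀ k → iter (rot G) k y₁ ≡ y₁
    stays zero    = refl
    stays (suc k) = trans (cong (rot G) (stays k)) fixed

  embedding : DartEmbedding G G'
  embedding = record
    { Changed      = Rem
    ; vmap         = mV
    ; dmap         = mD
    ; changed-opp  = removed-opp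
    ; bd-unchanged = bd-not-removed
    ; at-dmap      = at-m
    ; opp-dmap     = opp-m
    ; mult-dmap    = mult-m
    ; rot-dmap     = rot-m
    }

  open Embedding embedding i
  open Walks G i using ([_]; next; via)
  open Walks G' i using () renaming ([_] to [_]'; next to next')

  a a₂ : ℕ
  a  = mult G y₁
  a₂ = mult G y₂

  a<r : a < r
  a<r = subst (a <_) mult-sum (m<m+n a (mult-pos G y₂))

  a₂<r : a₂ < r
  a₂<r = subst (a₂ <_) mult-sum (m<n+m a₂ (mult-pos G y₁))

  module U  = S.Around u  y₁         y₁-at
  module P₁ = S.Around p₁ (opp G y₁) p₁-at
  module P₂ = S.Around p₂ (opp G y₂) p₂-at

  U-y₁ : ∀ p (p<m : p < a) → U.pos p ≡ (y₁ , p , p<m)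
  U-y₁ = U.pos-offset 0

  U-y₂ : ∀ p (p<m : p < a₂) → U.pos (a + p) ≡ (y₂ , p , p<m)
  U-y₂ p p<m = trans (U.pos-offset 1 p (subst (λ y → p < mult G y) (sym rot-y₁) p<m)) (S.strandEnd-≡ rot-y₁ refl)

  P₁-opp-y₁ : ∀ p (p<m : p < mult G (opp G y₁)) → P₁.pos p ≡ (opp G y₁ , p , p<m)
  P₁-opp-y₁ = P₁.pos-offset 0

  P₂-opp-y₂ : ∀ p (p<m : p < mult G (opp G y₂)) → P₂.pos p ≡ (opp G y₂ , p , p<m)
  P₂-opp-y₂ = P₂.pos-offset 0

  P₁-a : P₁.pos a ≡ S.first (rot G (opp G y₁))
  P₁-a = trans (cong P₁.pos (sym (trans (+-identityʳ _) (mult-opp G y₁)))) (P₁.pos-offset 1 0 (mult-pos G _))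

  P₂-a₂ : P₂.pos a₂ ≡ S.first (rot G (opp G y₂))
  P₂-a₂ = trans (cong P₂.pos (sym (trans (+-identityʳ _) (mult-opp G y₂)))) (P₂.pos-offset 1 0 (mult-pos G _))

  outside-P₁ : ∀ t → a ≤ t → t < r → ¬ Rem (proj₁ (P₁.pos t))
  outside-P₁ t a≤t t<r rem = <-irrefl (sym t≡p) (<-≤-trans p<a a≤t)
    where
    p = proj₁ (proj₂ (P₁.pos t))
    is-opp-y₁ : proj₁ (P₁.pos t) ≡ opp G y₁
    is-opp-y₁ = removed-at-p₁ rem (P₁.at-pos t)
    p<m : p < mult G (opp G y₁)
    p<m = subst (λ y → p < mult G y) is-opp-y₁ (proj₂ (proj₂ (P₁.pos t)))
    p<a : p < a
    p<a = subst (p <_) (mult-opp G y₁) p<m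
    t≡p : t ≡ p
    t≡p = P₁.pos-injective t<r (<-trans p<a a<r)
            (trans (S.strandEnd-≡ is-opp-y₁ refl) (sym (P₁-opp-y₁ p p<m)))

  outside-P₂ : ∀ t → a₂ ≤ t → t < r → ¬ Rem (proj₁ (P₂.pos t))
  outside-P₂ t a₂≤t t<r rem = <-irrefl (sym t≡p) (<-≤-trans p<a₂ a₂≤t)
    where
    p = proj₁ (proj₂ (P₂.pos t))
    is-opp-y₂ : proj₁ (P₂.pos t) ≡ opp G y₂
    is-opp-y₂ = removed-at-p₂ rem (P₂.at-pos t)
    p<m : p < mult G (opp G y₂)
    p<m = subst (λ y → p < mult G y) is-opp-y₂ (proj₂ (proj₂ (P₂.pos t)))
    p<a₂ : p < a₂
    p<a₂ = subst (p <_) (mult-opp G y₂) p<m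
    t≡p : t ≡ p
    t≡p = P₂.pos-injective t<r (<-trans p<a₂ a₂<r)
            (trans (S.strandEnd-≡ is-opp-y₂ refl) (sym (P₂-opp-y₂ p p<m)))

  b₀ : Fin (nD G)
  b₀ = rot G (opp G y₁)

  b₀-kept : ¬ Rem b₀
  b₀-kept = subst (¬_ ∘ Rem ∘ proj₁) P₁-a (outside-P₁ a ≤-refl a<r)

  b₀-at' : at G' (mD b₀) ≡ inj₁ (mV p₁)
  b₀-at' = trans (at-m b₀ b₀-kept) (cong (map₁ mV) (trans (rot-at G (opp G y₁)) p₁-at))

  module P = S'.Around (mV p₁) (mD b₀) b₀-at'

  P₁∼P : ∀ t → t < a₂ → P₁.pos (a + t) ∼ P.pos t
  P₁∼P zero    _      = ∼-subst (sym (trans (cong P₁.pos (+-identityʳ a)) P₁-a)) refl (corr b₀-kept refl refl)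
  P₁∼P (suc t) 1+t<a₂ = ∼-subst (cong P₁.pos (sym (+-suc a t))) refl
    (cw-∼ (P₁∼P t (<-trans (n<1+n t) 1+t<a₂))
          (outside-P₁ (suc (a + t)) (≤-trans (m≤m+n a t) (n≤1+n _)) 1+a+t<r))
    where
    1+a+t<r : suc (a + t) < r
    1+a+t<r = subst (_< r) (+-suc a t) (subst (a + suc t <_) mult-sum (+-monoʳ-< a 1+t<a₂))

  -- Where p₁'s rotation would reach the deleted edge of y₁, the merged vertex continues with p₂'s darts.
  jump : ∀ {s s'} → s ∼ s' → proj₁ (cw G s) ≡ opp G y₁ → ¬ Rem (rot G (opp G y₂)) →
         S.first (rot G (opp G y₂)) ∼ cw G' s'
  jump {y , p , _} {_ , _ , _} (corr y-kept refl refl) reaches-e₁ kept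
    with suc p <? mult G y | suc p <? mult G' (mD y)
  ... | yes _    | _        = ⊥-elim (y-kept (inj₂ (inj₂ (inj₁ reaches-e₁))))
  ... | no  1+p≮ | yes 1+p< = ⊥-elim (1+p≮ (subst (suc p <_) (mult-m y y-kept) 1+p<))
  ... | no  _    | no  _    = corr kept (rot-m₁ y y-kept reaches-e₁) refl

  P₂∼P : ∀ t → a₂ ≤ t → t < r → P₂.pos t ∼ P.pos t
  P₂∼P t a₂≤t t<r with m≤n⇒∃[o]m+o≡n a₂≤t
  ... | o , refl = from o t<r
    where
    from : ∀ o → a₂ + o < r → P₂.pos (a₂ + o) ∼ P.pos (a₂ + o)
    from zero _ with m≤n⇒∃[o]m+o≡n (mult-pos G y₂)
    ... | t₀ , 1+t₀≡a₂ =
          ∼-subst (sym (trans (cong P₂.pos (+-identityʳ a₂)) P₂-a₂))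
                  (cong P.pos (trans 1+t₀≡a₂ (sym (+-identityʳ a₂))))
                  (jump (P₁∼P t₀ (≤-reflexive 1+t₀≡a₂)) reaches-e₁ kept)
      where
      reaches-e₁ : proj₁ (cw G (P₁.pos (a + t₀))) ≡ opp G y₁
      reaches-e₁ = cong proj₁ (trans (cong P₁.pos 1+a+t₀≡r) P₁.pos-r)
        where
        1+a+t₀≡r : suc (a + t₀) ≡ r
        1+a+t₀≡r = trans (sym (+-suc a t₀)) (trans (cong (a +_) 1+t₀≡a₂) mult-sum)
      kept : ¬ Rem (rot G (opp G y₂))
      kept = subst (¬_ ∘ Rem ∘ proj₁) P₂-a₂ (outside-P₂ a₂ ≤-refl a₂<r)
    from (suc o) a₂+1+o<r = ∼-subst (cong P₂.pos (sym (+-suc a₂ o))) (cong P.pos (sym (+-suc a₂ o)))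
      (cw-∼ (from o (<-trans (n<1+n _) 1+a₂+o<r))
            (outside-P₂ (suc (a₂ + o)) (≤-trans (m≤m+n a₂ o) (n≤1+n _)) 1+a₂+o<r))
      where
      1+a₂+o<r : suc (a₂ + o) < r
      1+a₂+o<r = subst (_< r) (+-suc a₂ o) a₂+1+o<r

  cross-p₁u : ∀ {d} → d < a → cross G (P₁.pos d) ≡ U.pos d
  cross-p₁u {d} d<a = trans (cong (cross G) (P₁-opp-y₁ d (subst (d <_) (sym (mult-opp G y₁)) d<a)))
                            (trans (S.strandEnd-≡ (opp-invol G y₁) refl) (sym (U-y₁ d d<a)))

  cross-p₂u : ∀ {d} → d < a₂ → cross G (P₂.pos d) ≡ U.pos (a + d)
  cross-p₂u {d} d<a₂ = trans (cong (cross G) (P₂-opp-y₂ d (subst (d <_) (sym (mult-opp G y₂)) d<a₂)))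
                             (trans (S.strandEnd-≡ (opp-invol G y₂) refl) (sym (U-y₂ d d<a₂)))

  cross-up₁ : ∀ {o} → o < a → cross G (U.pos o) ≡ P₁.pos o
  cross-up₁ {o} o<a =
    trans (cong (cross G) (U-y₁ o o<a)) (sym (P₁-opp-y₁ o (subst (o <_) (sym (mult-opp G y₁)) o<a)))

  cross-up₂ : ∀ {o} → o < a₂ → cross G (U.pos (a + o)) ≡ P₂.pos o
  cross-up₂ {o} o<a₂ =
    trans (cong (cross G) (U-y₂ o o<a₂)) (sym (P₂-opp-y₂ o (subst (o <_) (sym (mult-opp G y₂)) o<a₂)))

  α β : ℕ
  α = advance r i (flipColor (color G u))
  β = advance r i (color G u)

  private
    i≤r : i ≤ r
    i≤r = <⇒≤ i<r

  α+β≡r : α + β ≡ r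
  α+β≡r = trans (+-comm α β) (advance-flip i≤r (color G u))

  α<r : α < r
  α<r = advance-< 0<i i<r (flipColor (color G u))

  color-neighbour : ∀ {y q} → at G y ≡ inj₁ u → at G (opp G y) ≡ inj₁ q →
                    color G q ≡ flipColor (color G u)
  color-neighbour y-at opp-at = ≢⇒flipColor (bipartite G _ u _ y-at opp-at)

  next-P₁ : ∀ X → next p₁ (P₁.pos X) ≡ cross G (P₁.pos (X + α))
  next-P₁ X = cong (cross G) (trans (cong (λ c → turn G c i (P₁.pos X)) (color-neighbour y₁-at p₁-at))
                                    (P₁.turn-pos i≤r (flipColor (color G u)) X))

  next-P₂ : ∀ X → next p₂ (P₂.pos X) ≡ cross G (P₂.pos (X + α))
  next-P₂ X = cong (cross G) (trans (cong (λ c → turn G c i (P₂.pos X)) (color-neighbour y₂-at p₂-at))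
                                    (P₂.turn-pos i≤r (flipColor (color G u)) X))

  next-U : ∀ X → next u (U.pos X) ≡ cross G (U.pos (X + β))
  next-U X = cong (cross G) (U.turn-pos i≤r (color G u) X)

  next-P : ∀ X → next' (mV p₁) (P.pos X) ≡ cross G' (P.pos (X + α))
  next-P X = cong (cross G') (trans (cong (λ c → turn G' c i (P.pos X)) color-merged)
                                    (P.turn-pos i≤r (flipColor (color G u)) X))
    where
    color-merged : color G' (mV p₁) ≡ flipColor (color G u)
    color-merged = trans (color-m p₁ (u≢p₁ ∘ sym)) (color-neighbour y₁-at p₁-at)

  hop-p₁u : ∀ X {d} → Wrap r (X + α) d → d < a → next p₁ (P₁.pos X) ≡ U.pos d
  hop-p₁u X w d<a = trans (next-P₁ X) (trans (cong (cross G) (P₁.pos-wrap w)) (cross-p₁u d<a))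

  hop-p₂u : ∀ X {d} → Wrap r (X + α) d → d < a₂ → next p₂ (P₂.pos X) ≡ U.pos (a + d)
  hop-p₂u X w d<a₂ = trans (next-P₂ X) (trans (cong (cross G) (P₂.pos-wrap w)) (cross-p₂u d<a₂))

  hop-up₁ : ∀ X {o} → Wrap r (X + β) o → o < a → next u (U.pos X) ≡ P₁.pos o
  hop-up₁ X w o<a = trans (next-U X) (trans (cong (cross G) (U.pos-wrap w)) (cross-up₁ o<a))

  hop-up₂ : ∀ X {o} → Wrap r (X + β) (a + o) → o < a₂ → next u (U.pos X) ≡ P₂.pos o
  hop-up₂ X w o<a₂ = trans (next-U X) (trans (cong (cross G) (U.pos-wrap w)) (cross-up₂ o<a₂))

  exit-p₁ : ∀ X Y {Z} → Wrap r (X + α) (a + Z) → Wrap r (Y + α) Z → Z < a₂ →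
            next p₁ (P₁.pos X) ∼ next' (mV p₁) (P.pos Y)
  exit-p₁ X Y w w' Z<a₂ =
    ∼-subst (sym (trans (next-P₁ X) (cong (cross G) (P₁.pos-wrap w))))
            (sym (trans (next-P Y) (cong (cross G') (P.pos-wrap w'))))
            (cross-∼ (P₁∼P _ Z<a₂))

  exit-p₂ : ∀ X Y {Z} → Wrap r (X + α) Z → Wrap r (Y + α) Z → a₂ ≤ Z → Z < r →
            next p₂ (P₂.pos X) ∼ next' (mV p₁) (P.pos Y)
  exit-p₂ X Y w w' a₂≤Z Z<r =
    ∼-subst (sym (trans (next-P₂ X) (cong (cross G) (P₂.pos-wrap w))))
            (sym (trans (next-P Y) (cong (cross G') (P.pos-wrap w'))))
            (cross-∼ (P₂∼P _ a₂≤Z Z<r))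

  open ContractionArithmetic a a₂ r α β mult-sum α+β≡r

  rejoin-from-p₁ : ∀ {o} → o < a₂ → Rejoins (P₁.pos (a + o)) (P.pos o)
  rejoin-from-p₁ {o} o<a₂ with <⊎≥+ (o + α) a₂
  ... | inj₁ o+α<a₂ =
        _ , _ , [ P₁.at-pos (a + o) ] , [ P.at-pos o ]' ,
        exit-p₁ (a + o) o (inj₁ (+-assoc a o α)) (inj₁ refl) o+α<a₂
  ... | inj₂ (d , E) with <⊎≥+ d a
  ...   | inj₁ d<a =
          _ , _ ,
          via (P₁.at-pos (a + o)) (hop-p₁u (a + o) (inj₂ lands) d<a)
            (via (U.at-pos d) (hop-up₂ d (inj₁ turn-at-u) o<a₂) [ P₂.at-pos o ]) ,
          [ P.at-pos o ]' ,
          exit-p₂ o o (inj₁ (sym E)) (inj₁ (sym E)) (m≤m+n a₂ d) (exit<r d<a)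
    where open FromP₁ E
  ...   | inj₂ (o₂ , refl) =
          _ , _ , [ P₁.at-pos (a + o) ] , [ P.at-pos o ]' ,
          exit-p₁ (a + o) o (inj₂ lands) (inj₂ lands') (o₂<a₂ o<a₂ α<r)
    where open FromP₁Wrapped E

  rejoin-from-p₂ : ∀ {o} → o < a → Rejoins (P₂.pos (a₂ + o)) (P.pos (a₂ + o))
  rejoin-from-p₂ {o} o<a with <⊎≥+ (o + α) a
  ... | inj₁ o+α<a =
        _ , _ , [ P₂.at-pos (a₂ + o) ] , [ P.at-pos (a₂ + o) ]' ,
        exit-p₂ (a₂ + o) (a₂ + o) (inj₁ refl) (inj₁ refl) (≤-trans (m≤m+n a₂ o) (m≤m+n _ α))
                (direct-exit<r o+α<a)
  ... | inj₂ (d , E) with <⊎≥+ d a₂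
  ...   | inj₁ d<a₂ =
          _ , _ ,
          via (P₂.at-pos (a₂ + o)) (hop-p₂u (a₂ + o) (inj₂ lands) d<a₂)
            (via (U.at-pos (a + d)) (hop-up₁ (a + d) (inj₂ turn-at-u) o<a) [ P₁.at-pos o ]) ,
          [ P.at-pos (a₂ + o) ]' ,
          exit-p₁ o (a₂ + o) (inj₁ (sym E)) (inj₂ lands) d<a₂
    where open FromP₂ E
  ...   | inj₂ (o₂ , refl) =
          _ , _ , [ P₂.at-pos (a₂ + o) ] , [ P.at-pos (a₂ + o) ]' ,
          exit-p₂ (a₂ + o) (a₂ + o) (inj₂ lands) (inj₂ lands) (m≤m+n a₂ o₂) (exit<r o<a α<r)
    where open FromP₂Wrapped E

  rejoin-at-p₁ : ∀ {s s'} → s ∼ s' → at G (proj₁ s) ≡ inj₁ p₁ → Rejoins s s'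
  rejoin-at-p₁ {s} s∼s' s-at with P₁.pos-surjective s s-at
  ... | e , e<r , refl with <⊎≥+ e a
  ...   | inj₁ e<a =
          ⊥-elim (unchanged s∼s' (subst (Rem ∘ proj₁) (sym (P₁-opp-y₁ e e<m)) (inj₂ (inj₂ (inj₁ refl)))))
    where
    e<m : e < mult G (opp G y₁)
    e<m = subst (e <_) (sym (mult-opp G y₁)) e<a
  ...   | inj₂ (o , refl) =
          subst (Rejoins (P₁.pos e)) (∼-functional (P₁∼P o o<a₂) s∼s') (rejoin-from-p₁ o<a₂)
    where
    o<a₂ : o < a₂
    o<a₂ = +-cancelˡ-< a o a₂ (subst (a + o <_) (sym mult-sum) e<r)

  rejoin-at-p₂ : ∀ {s s'} → s ∼ s' → at G (proj₁ s) ≡ inj₁ p₂ → Rejoins s s'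
  rejoin-at-p₂ {s} s∼s' s-at with P₂.pos-surjective s s-at
  ... | e , e<r , refl with <⊎≥+ e a₂
  ...   | inj₁ e<a₂ =
          ⊥-elim (unchanged s∼s' (subst (Rem ∘ proj₁) (sym (P₂-opp-y₂ e e<m)) (inj₂ (inj₂ (inj₂ refl)))))
    where
    e<m : e < mult G (opp G y₂)
    e<m = subst (e <_) (sym (mult-opp G y₂)) e<a₂
  ...   | inj₂ (o , refl) =
          subst (Rejoins (P₂.pos e)) (∼-functional (P₂∼P e (m≤m+n a₂ o) e<r) s∼s') (rejoin-from-p₂ o<a)
    where
    o<a : o < a
    o<a = +-cancelˡ-< a₂ o a (subst (a₂ + o <_) (trans (sym mult-sum) (+-comm a a₂)) e<r)

  rejoin : ∀ {s s' q} → s ∼ s' → at G (proj₁ s) ≡ inj₁ q → Rejoins s s'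
  rejoin {s} {q = q} s∼s' s-at with q ≟ p₁ | q ≟ p₂ | q ≟ u
  ... | yes refl | _        | _        = rejoin-at-p₁ s∼s' s-at
  ... | no _     | yes refl | _        = rejoin-at-p₂ s∼s' s-at
  ... | no _     | no _     | yes refl = ⊥-elim (unchanged s∼s' (map₂ inj₁ (simple-deg-2 (proj₁ s) s-at)))
  ... | no q≢p₁  | no q≢p₂  | no q≢u   = rejoin-untouched untouched (color-m q q≢u) s∼s' s-at
    where
    untouched : Untouched q
    untouched z z-at rem with removed-at rem z-at
    ... | inj₁ q≡u        = q≢u q≡u
    ... | inj₂ (inj₁ q≡p₁) = q≢p₁ q≡p₁
    ... | inj₂ (inj₂ q≡p₂) = q≢p₂ q≡p₂

  contraction-trip⇔ : ∀ j k → Trip G i j k ⇔ Trip G' i j k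
  contraction-trip⇔ = trip⇔ rejoin

module _ {r n i : ℕ} (0<i : 0 < i) (i<r : i < r) where

  contractions-trip⇔ : ∀ {G G' : HPG r n} → Star Contraction G G' → ∀ j k → Trip G i j k ⇔ Trip G' i j k
  contractions-trip⇔ ε          j k = ⇔-id _
  contractions-trip⇔ (c ◅ rest) j k =
    contractions-trip⇔ rest j k ⇔-∘ ContractionWalks.contraction-trip⇔ c 0<i i<r j k

  square-then-contract-trip⇔ : ∀ {G G' : HPG r n} → SquareThenContract G G' →
                                ∀ j k → Trip G i j k ⇔ Trip G' i j k
  square-then-contract-trip⇔ (_ , square , contractions) j k =
    contractions-trip⇔ contractions j k ⇔-∘ SquareMoveWalks.square-trip⇔ square 0<i i<r j k

m≤n∸1⇒m<n : ∀ {m} n → 0 < m → m ≤ n ∸ 1 → m < n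
m≤n∸1⇒m<n zero    (s≤s _) ()
m≤n∸1⇒m<n (suc n) _       m≤n = s≤s m≤n

theorem5p7 : ∀ {r n} (G G' : HPG r n) → RelatedBySquareMove G G' →
    ∀ (i : ℕ) → 1 ≤ i → i ≤ r ∸ 1 →
    ∀ (j k : Fin n) → Trip G i j k ⇔ Trip G' i j k
theorem5p7 {r} G G' (inj₁ G⇒G') i 1≤i i≤r∸1 j k =
  square-then-contract-trip⇔ 1≤i (m≤n∸1⇒m<n r 1≤i i≤r∸1) G⇒G' j k
theorem5p7 {r} G G' (inj₂ G'⇒G) i 1≤i i≤r∸1 j k =
  ⇔-sym (square-then-contract-trip⇔ 1≤i (m≤n∸1⇒m<n r 1≤i i≤r∸1) G'⇒G j k)
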